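{- If $H=\Delta$ (in type B or type C), then the set $\{\mathbf{f}_i^A : i\in[n],\ A\subseteq[\bar n]\text{ unbalanced},\ |A|=i\}$ is a $\mathbb{C}$-basis of $\mathcal{M}_\Delta^1$.
   Context: Let $n\ge 2$, $[n]=\{1,\dots,n\}$, $[\bar n]=\{\pm1,\dots,\pm n\}$, $\bar i=-i$. $\mathfrak{W}_n$ is the group of bijections $w$ of $[\bar n]$ with $w(\bar i)=\overline{w(i)}$. Simple reflections: $s_i$ exchanges $i\leftrightarrow i+1$ and $\bar i\leftrightarrow\overline{i+1}$ ($i<n$), $s_n$ exchanges $n\leftrightarrow\bar n$. $\Delta$ is the set of simple roots, whose reflections are $s_1,\dots,s_n$. With $x_{\bar k}:=-x_k$ in $\mathbb{C}[x_1,\dots,x_n]$, $\mathcal{M}_\Delta$ is the set of $\rho:\mathfrak{W}_n\to\mathbb{C}[x_1,\dots,x_n]$ such that for all $w$ and each simple reflection $s$ exchanging $p$ and $q$ ($q\ne p$, possibly $q=\bar p$), $\rho(w)-\rho(ws)\in\langle x_{w(p)}-x_{w(q)}\rangle$; $\mathcal{M}_\Delta^1$ consists of those whose values are all linear forms (or $0$). A set $A\subseteq[\bar n]$ is unbalanced if $a\in A$ implies $\bar a\notin A$. For $|A|=i$: $\mathbf{f}_i^A(w)=x_{w(i)}-x_{w(i+1)}$ if $w([i])=A$ and $i<n$; $\mathbf{f}_n^A(w)=x_{w(n)}$ if $w([n])=A$; and $\mathbf{f}_i^A(w)=0$ otherwise. -}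

module Defs where

open import Level using (Level; _⊔_) renaming (suc to lsuc)
open import Algebra.Bundles using (CommutativeRing)
open import Data.Nat as ℕ using (ℕ; zero; suc; _<_; _<?_)
open import Data.Bool using (Bool; true; false; T; if_then_else_)
open import Data.Fin as Fin using (Fin; toℕ; fromℕ<; join; _≤_)
open import Data.Fin.Properties using (all?; any?) renaming (_≟_ to _≟F_; _≤?_ to _≤?F_)
open import Data.Fin.Subset using (Subset; _∈_; _∉_; ∣_∣)
open import Data.Fin.Subset.Properties using (_∈?_)
open import Data.Sum using (_⊎_; inj₁; inj₂)
import Data.Sum.Properties as SumP
open import Data.Product using (Σ; ∃; _×_; _,_; proj₁)
open import Data.Vec using (Vec; lookup; tabulate; []; _∷_)
import Data.Vec.Properties as VecP
open import Data.List using (List; []; _∷_; filter; cartesianProduct; map; foldr; _++_)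
open import Data.List.Base using (allFin)
open import Relation.Nullary using (¬_; Dec; yes; no; does)
open import Relation.Nullary.Decidable using (_×-dec_; _→-dec_; ¬?)
open import Relation.Binary.PropositionalEquality using (_≡_; refl)
import Data.Bool.Properties as BoolP

record Field (c ℓ : Level) : Set (lsuc (c ⊔ ℓ)) where
  field
    commutativeRing : CommutativeRing c ℓ
  open CommutativeRing commutativeRing public
  field
    0≉1     : ¬ (0# ≈ 1#)
    inverse : ∀ x → ¬ (x ≈ 0#) → ∃ λ y → (x * y) ≈ 1#

  ι : ℕ → Carrier
  ι zero    = 0#
  ι (suc m) = 1# + ι m

CharZero : ∀ {c ℓ} → Field c ℓ → Set ℓ
CharZero F = ∀ m → ¬ (ι (suc m) ≈ 0#)
  where open Field F

-- Signed indices [n̄] = {±1,…,±n}.  Index k ∈ [n] is encoded (0-based)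
-- by j : Fin n with k = toℕ j + 1;  inj₁ j stands for +k, inj₂ j for -k.

SI : ℕ → Set
SI n = Fin n ⊎ Fin n

bar : ∀ {n} → SI n → SI n
bar (inj₁ j) = inj₂ j
bar (inj₂ j) = inj₁ j

absSI : ∀ {n} → SI n → Fin n
absSI (inj₁ j) = j
absSI (inj₂ j) = j

_≟SI_ : ∀ {n} (a b : SI n) → Dec (a ≡ b)
_≟SI_ = SumP.≡-dec _≟F_ _≟F_

-- An element w (a bijection of [n̄]
-- with w(ī) = \overline{w(i)}) is encoded by the vector of values
-- (w(1),…,w(n)); such a vector defines an element iff the absolute
-- values are pairwise distinct (checked by a Boolean, whose proofs are
-- unique, so equal vectors give equal group elements).

distinctAbs : ∀ {n} → Vec (SI n) n → Bool
distinctAbs v = does (all? λ j → all? λ j' →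
  (absSI (lookup v j) ≟F absSI (lookup v j')) →-dec (j ≟F j'))

W : ℕ → Set
W n = Σ (Vec (SI n) n) (λ v → T (distinctAbs v))

act : ∀ {n} → W n → SI n → SI n
act (v , _) (inj₁ j) = lookup v j
act (v , _) (inj₂ j) = bar (lookup v j)

-- Simple reflections s_k (k : Fin n, 0-based, s_k = s_{toℕ k + 1}).
-- sPair k = (p , q), the two elements exchanged by s_k:
--   (k+1, k+2) for toℕ k + 1 < n, and (n, n̄) for the last one.

sPair : ∀ {n} → Fin n → SI n × SI n
sPair {n} k with suc (toℕ k) <? n
... | yes lt = inj₁ k , inj₁ (fromℕ< lt)
... | no _   = inj₁ k , inj₂ k

swapSI : ∀ {n} → SI n → SI n → SI n → SI n
swapSI p q a with a ≟SI p
... | yes _ = q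
... | no _ with a ≟SI q
...   | yes _ = p
...   | no _ with a ≟SI bar p
...     | yes _ = bar q
...     | no _ with a ≟SI bar q
...       | yes _ = bar p
...       | no _  = a

sRef : ∀ {n} → Fin n → SI n → SI n
sRef k = swapSI (proj₁ (sPair k)) (Data.Product.proj₂ (sPair k))

module _ {c ℓ} (F : Field c ℓ) where
  open Field F

  LF : ℕ → Set c
  LF n = Fin n → Carrier

  zeroLF : ∀ {n} → LF n
  zeroLF _ = 0#

  var : ∀ {n} → SI n → LF n
  var (inj₁ j) k = if does (j ≟F k) then 1# else 0#
  var (inj₂ j) k = - (if does (j ≟F k) then 1# else 0#)

  _-L_ : ∀ {n} → LF n → LF n → LF n
  (f -L g) k = f k - g k

  -- membership of a linear form L in the principal ideal ⟨ℓ'⟩ of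
  -- K[x_1,…,x_n] generated by a linear form ℓ': by degree reasons this
  -- means L = c·ℓ' for a scalar c.
  InIdeal : ∀ {n} → LF n → LF n → Set (c ⊔ ℓ)
  InIdeal L ℓ' = ∃ λ (a : Carrier) → ∀ k → L k ≈ (a * ℓ' k)

  -- 𝓜_Δ^1 : maps ρ : 𝔚_n → (linear forms) such that for all w and every
  -- simple reflection s exchanging p,q:  ρ(w) - ρ(ws) ∈ ⟨x_{w(p)} - x_{w(q)}⟩.
  -- ws is the (unique) w' with w'(a) = w(s(a)) for all a.
  InM1 : ∀ n → (W n → LF n) → Set (c ⊔ ℓ)
  InM1 n ρ = ∀ (w w' : W n) (k : Fin n) →
    (∀ a → act w' a ≡ act w (sRef k a)) →
    InIdeal (ρ w -L ρ w')
            (var (act w (proj₁ (sPair k))) -L var (act w (Data.Product.proj₂ (sPair k))))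

-- Subsets of [n̄]: Subset (n + n), where signed index a corresponds to
-- join n n a : Fin (n + n).

toF : ∀ {n} → SI n → Fin (n ℕ.+ n)
toF {n} a = join n n a

-- w([i]) = {w(1),…,w(i)}; here i is encoded 0-based by i : Fin n,
-- so [i] = {j : Fin n | toℕ j ≤ toℕ i}.
image : ∀ {n} → W n → Fin n → Subset (n ℕ.+ n)
image {n} w i = tabulate λ m →
  does (any? λ j → (j ≤?F i) ×-dec (toF (act w (inj₁ j)) Fin.≟ m))

Unbalanced : ∀ {n} → Subset (n ℕ.+ n) → Set
Unbalanced {n} A = ∀ (a : SI n) → toF a ∈ A → toF (bar a) ∉ A

-- valid index (i, A): A unbalanced with |A| = i  (i 1-based = toℕ i + 1)
Valid : ∀ {n} → Fin n → Subset (n ℕ.+ n) → Set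
Valid {n} i A = Unbalanced {n} A × ∣ A ∣ ≡ suc (toℕ i)

private
  allSI? : ∀ {n} {P : SI n → Set} → (∀ a → Dec (P a)) → Dec (∀ a → P a)
  allSI? {P = P} P? with all? (λ j → P? (inj₁ j)) | all? (λ j → P? (inj₂ j))
  ... | yes p | yes q = yes λ { (inj₁ j) → p j ; (inj₂ j) → q j }
  ... | no ¬p | _     = no λ h → ¬p (λ j → h (inj₁ j))
  ... | yes _ | no ¬q = no λ h → ¬q (λ j → h (inj₂ j))

valid? : ∀ {n} (iA : Fin n × Subset (n ℕ.+ n)) → Dec (Valid (proj₁ iA) (Data.Product.proj₂ iA))
valid? {n} (i , A) =
  allSI? {n} (λ a → (toF {n} a ∈? A) →-dec ¬? (toF (bar a) ∈? A))
  ×-dec (∣ A ∣ ℕ.≟ suc (toℕ i))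

allSubsets : ∀ m → List (Subset m)
allSubsets zero    = [] ∷ []
allSubsets (suc m) = map (true ∷_) (allSubsets m) ++ map (false ∷_) (allSubsets m)

indexList : ∀ n → List (Fin n × Subset (n ℕ.+ n))
indexList n = filter valid? (cartesianProduct (allFin n) (allSubsets (n ℕ.+ n)))

module _ {c ℓ} (F : Field c ℓ) where
  open Field F

  fForm : ∀ {n} → W n → Fin n → LF F n
  fForm {n} w i with suc (toℕ i) <? n
  ... | yes lt = _-L_ F (var F (act w (inj₁ i))) (var F (act w (inj₁ (fromℕ< lt))))
  ... | no _   = var F (act w (inj₁ i))

  𝐟 : ∀ {n} → Fin n → Subset (n ℕ.+ n) → W n → LF F n
  𝐟 i A w with VecP.≡-dec BoolP._≟_ (image w i) A
  ... | yes _ = fForm w i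
  ... | no _  = zeroLF F

  combo : ∀ {n} → (Fin n → Subset (n ℕ.+ n) → Carrier) → W n → LF F n
  combo {n} coef w k =
    foldr (λ iA acc → (coef (proj₁ iA) (Data.Product.proj₂ iA) *
                       𝐟 (proj₁ iA) (Data.Product.proj₂ iA) w k) + acc)
          0# (indexList n)

  IsBasisOfM1 : ℕ → Set (c ⊔ ℓ)
  IsBasisOfM1 n =
    (∀ i A → Valid {n} i A → InM1 F n (𝐟 {n} i A))
    × (∀ (coef : Fin n → Subset (n ℕ.+ n) → Carrier) →
         (∀ w k → combo coef w k ≈ 0#) →
         ∀ i A → Valid {n} i A → coef i A ≈ 0#)
    × (∀ (ρ : W n → LF F n) → InM1 F n ρ →
         ∃ λ (coef : Fin n → Subset (n ℕ.+ n) → Carrier) →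
           ∀ w k → combo coef w k ≈ ρ w k)

-- For w ∈ 𝔚_n the forms f_i(w) = x_{w(i)} - x_{w(i+1)} (i < n) and f_n(w) = x_{w(n)}
-- form a basis of the linear forms, and the coordinates of L in this basis are the partial sums
-- Φ_i(w, L) = Σ_{j ≤ i} (coefficient of x_{w(j)} in L).  Since f_i^A(w) is f_i(w) when A = w([i])
-- and 0 otherwise, Σ_{i,A} c_{i,A} f_i^A(w) = Σ_i c_{i,w([i])} f_i(w).
-- Independence: every unbalanced A with |A| = i is some w([i]), and then the coordinates force
-- c_{i,A} = 0.  Spanning: ρ(w) = Σ_i Φ_i(w, ρ(w)) f_i(w), so it suffices that Φ_i(w, ρ(w)) depends
-- only on w([i]).  For k ≠ i the functional Φ_i(w, -) kills x_{w(k)} - x_{w s_k(k)} and is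
-- unchanged by w ↦ w s_k, so the condition defining 𝓜_Δ makes Φ_i(w, ρ(w)) invariant under these
-- steps; and any two w with the same w([i]) are joined by such steps, by sorting the positions
-- one at a time.  Finally f_i^A ∈ 𝓜_Δ is a direct check, which for s_n uses x = ½ (x - (-x)).

module Submission where

open import Algebra.Bundles using (CommutativeRing)
open import Algebra.Definitions using (Involutive)
open import Data.Bool using (true; false; T; if_then_else_)
import Data.Bool.Properties as Bool
open import Data.Empty using (⊥-elim)
open import Data.Fin as Fin using (Fin; toℕ; fromℕ<; inject₁; splitAt)
open import Data.Fin.Induction using (<-weakInduction)
import Data.Fin.Permutation as Perm
open import Data.Fin.Permutation.Components using (transpose)
import Data.Fin.Properties as Fin
open import Data.Fin.Subset using (Subset)
open import Data.List as List using (List; []; _∷_; _++_; filter; cartesianProduct)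
open import Data.Nat as ℕ using (ℕ; zero; suc; s≤s; _≤_)
import Data.Nat.Properties as ℕ
open import Data.Product using (∃; ∃-syntax; _×_; _,_; proj₁; proj₂)
open import Data.Sum using (_⊎_; inj₁; inj₂)
open import Data.Vec using (tabulate; []; _∷_; here; there)
import Data.Vec.Properties as Vec
open import Function using (_∘_; flip)
open import Function.Bundles using (_⇔_; mk⇔; Equivalence)
open import Relation.Binary.Construct.Closure.ReflexiveTransitive using (Star; ε; _◅_; _◅◅_)
import Relation.Binary.PropositionalEquality as ≡
open ≡ using (_≡_; _≢_)
open import Relation.Nullary using (¬_; Dec; yes; no; does)
open import Relation.Nullary.Decidable using (dec-true; dec-false; _×-dec_)
open import Relation.Unary using (Pred; Decidable)

open import Defs

open Equivalence using (to; from)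

module Hyperoctahedral where

  open ≡ using (refl; sym; trans; cong; subst; subst₂)
  open Data.Fin.Subset using (_∈_; _∉_; _⊆_; _-_; ∣_∣; Nonempty)
  open import Data.Fin.Subset.Properties
    using (⊆-antisym; p─⊥≡p; p─q⊆p; x∈p∧x≢y⇒x∈p-y; Empty-unique; ∣⊥∣≡0; nonempty?)

  private
    variable
      m n : ℕ
      A : Set

  fromDoes : (d : Dec A) → T (does d) → A
  fromDoes (yes a) _ = a

  toDoes : (d : Dec A) → A → T (does d)
  toDoes (yes _) _ = _
  toDoes (no ¬a) a = ¬a a

  bar-involutive : (a : SI n) → bar (bar a) ≡ a
  bar-involutive (inj₁ _) = refl
  bar-involutive (inj₂ _) = refl

  absSI-bar : (a : SI n) → absSI (bar a) ≡ absSI a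
  absSI-bar (inj₁ _) = refl
  absSI-bar (inj₂ _) = refl

  a≢bar-a : (a : SI n) → a ≢ bar a
  a≢bar-a (inj₁ _) ()
  a≢bar-a (inj₂ _) ()

  absSI-injective : {a b : SI n} → absSI a ≡ absSI b → a ≡ b ⊎ a ≡ bar b
  absSI-injective {a = inj₁ j} {inj₁ .j} refl = inj₁ refl
  absSI-injective {a = inj₁ j} {inj₂ .j} refl = inj₂ refl
  absSI-injective {a = inj₂ j} {inj₁ .j} refl = inj₂ refl
  absSI-injective {a = inj₂ j} {inj₂ .j} refl = inj₁ refl

  toF-injective : {a b : SI n} → toF a ≡ toF b → a ≡ b
  toF-injective {n} {a} {b} e =
    trans (sym (Fin.splitAt-join n n a)) (trans (cong (splitAt n) e) (Fin.splitAt-join n n b))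

  module _ (p q : SI n) where

    swapSI-p : swapSI p q p ≡ q
    swapSI-p with p ≟SI p
    ... | yes _  = refl
    ... | no p≢p = ⊥-elim (p≢p refl)

    swapSI-q : swapSI p q q ≡ p
    swapSI-q with q ≟SI p
    ... | yes q≡p = q≡p
    ... | no _ with q ≟SI q
    ...   | yes _  = refl
    ...   | no q≢q = ⊥-elim (q≢q refl)

    swapSI-bar-p : swapSI p q (bar p) ≡ bar q
    swapSI-bar-p with bar p ≟SI p
    ... | yes e = ⊥-elim (a≢bar-a p (sym e))
    ... | no _ with bar p ≟SI q
    ...   | yes refl = sym (bar-involutive p)
    ...   | no _ with bar p ≟SI bar p
    ...     | yes _ = refl
    ...     | no ne = ⊥-elim (ne refl)

    swapSI-bar-q : swapSI p q (bar q) ≡ bar p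
    swapSI-bar-q with bar q ≟SI p
    ... | yes refl = sym (bar-involutive q)
    ... | no _ with bar q ≟SI q
    ...   | yes e = ⊥-elim (a≢bar-a q (sym e))
    ...   | no _ with bar q ≟SI bar p
    ...     | yes e = e
    ...     | no _ with bar q ≟SI bar q
    ...       | yes _ = refl
    ...       | no ne = ⊥-elim (ne refl)

    swapSI-other : ∀ {a} → a ≢ p → a ≢ q → a ≢ bar p → a ≢ bar q → swapSI p q a ≡ a
    swapSI-other {a} a≢p a≢q a≢p̄ a≢q̄ with a ≟SI p
    ... | yes e = ⊥-elim (a≢p e)
    ... | no _ with a ≟SI q
    ...   | yes e = ⊥-elim (a≢q e)
    ...   | no _ with a ≟SI bar p
    ...     | yes e = ⊥-elim (a≢p̄ e)
    ...     | no _ with a ≟SI bar q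
    ...       | yes e = ⊥-elim (a≢q̄ e)
    ...       | no _  = refl

    data SwapCase (a : SI n) : Set where
      at-p      : a ≡ p → SwapCase a
      at-q      : a ≡ q → SwapCase a
      at-bar-p  : a ≡ bar p → SwapCase a
      at-bar-q  : a ≡ bar q → SwapCase a
      elsewhere : a ≢ p → a ≢ q → a ≢ bar p → a ≢ bar q → SwapCase a

    swapCase : ∀ a → SwapCase a
    swapCase a with a ≟SI p | a ≟SI q | a ≟SI bar p | a ≟SI bar q
    ... | yes a≡p | _ | _ | _ = at-p a≡p
    ... | no _ | yes a≡q | _ | _ = at-q a≡q
    ... | no _ | no _ | yes a≡p̄ | _ = at-bar-p a≡p̄
    ... | no _ | no _ | no _ | yes a≡q̄ = at-bar-q a≡q̄
    ... | no a≢p | no a≢q | no a≢p̄ | no a≢q̄ = elsewhere a≢p a≢q a≢p̄ a≢q̄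

    swapSI-involutive : Involutive _≡_ (swapSI p q)
    swapSI-involutive a with swapCase a
    ... | at-p refl = trans (cong (swapSI p q) swapSI-p) swapSI-q
    ... | at-q refl = trans (cong (swapSI p q) swapSI-q) swapSI-p
    ... | at-bar-p refl = trans (cong (swapSI p q) swapSI-bar-p) swapSI-bar-q
    ... | at-bar-q refl = trans (cong (swapSI p q) swapSI-bar-q) swapSI-bar-p
    ... | elsewhere a≢p a≢q a≢p̄ a≢q̄ = trans (cong (swapSI p q) fixed) fixed
      where fixed = swapSI-other a≢p a≢q a≢p̄ a≢q̄

    swapSI-bar : ∀ a → swapSI p q (bar a) ≡ bar (swapSI p q a)
    swapSI-bar a with swapCase a
    ... | at-p refl = trans swapSI-bar-p (cong bar (sym swapSI-p))
    ... | at-q refl = trans swapSI-bar-q (cong bar (sym swapSI-q))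
    ... | at-bar-p refl =
      trans (cong (swapSI p q) (bar-involutive p))
            (trans swapSI-p (trans (sym (bar-involutive q)) (cong bar (sym swapSI-bar-p))))
    ... | at-bar-q refl =
      trans (cong (swapSI p q) (bar-involutive q))
            (trans swapSI-q (trans (sym (bar-involutive p)) (cong bar (sym swapSI-bar-q))))
    ... | elsewhere a≢p a≢q a≢p̄ a≢q̄ =
      trans (swapSI-other (a≢p̄ ∘ flipBar) (a≢q̄ ∘ flipBar) (a≢p ∘ unbar) (a≢q ∘ unbar))
            (cong bar (sym (swapSI-other a≢p a≢q a≢p̄ a≢q̄)))
      where
      flipBar : ∀ {b} → bar a ≡ b → a ≡ bar b
      flipBar refl = sym (bar-involutive a)
      unbar : ∀ {b} → bar a ≡ bar b → a ≡ b
      unbar {b} e = trans (sym (bar-involutive a)) (trans (cong bar e) (bar-involutive b))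

  transpose-matchˡ : (i j : Fin n) → transpose i j i ≡ j
  transpose-matchˡ i j rewrite dec-true (i Fin.≟ i) refl = refl

  transpose-matchʳ : (i j : Fin n) → transpose i j j ≡ i
  transpose-matchʳ i j with j Fin.≟ i
  ... | yes j≡i = j≡i
  ... | no _ rewrite dec-true (j Fin.≟ j) refl = refl

  transpose-other : {i j k : Fin n} → k ≢ i → k ≢ j → transpose i j k ≡ k
  transpose-other {i = i} {j} {k} k≢i k≢j
    rewrite dec-false (k Fin.≟ i) k≢i | dec-false (k Fin.≟ j) k≢j = refl

  data TransposeCase (i j k : Fin n) : Set where
    at-i      : k ≡ i → TransposeCase i j k
    at-j      : k ≢ i → k ≡ j → TransposeCase i j k
    elsewhere : k ≢ i → k ≢ j → TransposeCase i j k

  transposeCase : (i j k : Fin n) → TransposeCase i j k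
  transposeCase i j k with k Fin.≟ i | k Fin.≟ j
  ... | yes k≡i | _       = at-i k≡i
  ... | no k≢i  | yes k≡j = at-j k≢i k≡j
  ... | no k≢i  | no k≢j  = elsewhere k≢i k≢j

  transpose-involutive : (i j : Fin n) → Involutive _≡_ (transpose i j)
  transpose-involutive i j k with transposeCase i j k
  ... | at-i refl = trans (cong (transpose k j) (transpose-matchˡ k j)) (transpose-matchʳ k j)
  ... | at-j _ refl = trans (cong (transpose i k) (transpose-matchʳ i k)) (transpose-matchˡ i k)
  ... | elsewhere k≢i k≢j =
    trans (cong (transpose i j) (transpose-other k≢i k≢j)) (transpose-other k≢i k≢j)

  swapSI-inj₁ : (k k′ j : Fin n) → swapSI (inj₁ k) (inj₁ k′) (inj₁ j) ≡ inj₁ (transpose k k′ j)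
  swapSI-inj₁ k k′ j with swapCase (inj₁ k) (inj₁ k′) (inj₁ j)
  ... | at-p refl = trans (swapSI-p (inj₁ k) (inj₁ k′)) (cong inj₁ (sym (transpose-matchˡ k k′)))
  ... | at-q refl = trans (swapSI-q (inj₁ k) (inj₁ k′)) (cong inj₁ (sym (transpose-matchʳ k k′)))
  ... | elsewhere j≢k j≢k′ _ _ =
    trans (swapSI-other (inj₁ k) (inj₁ k′) j≢k j≢k′ (λ ()) (λ ()))
          (cong inj₁ (sym (transpose-other (j≢k ∘ cong inj₁) (j≢k′ ∘ cong inj₁))))

  pos : W n → Fin n → SI n
  pos w j = act w (inj₁ j)

  act-bar : (w : W n) (a : SI n) → act w (bar a) ≡ bar (act w a)
  act-bar w (inj₁ j) = refl
  act-bar w (inj₂ j) = sym (bar-involutive _)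

  absSI-act : (w : W n) (a : SI n) → absSI (act w a) ≡ absSI (pos w (absSI a))
  absSI-act w (inj₁ j) = refl
  absSI-act w (inj₂ j) = absSI-bar (pos w j)

  absSI-pos-injective : (w : W n) {j j′ : Fin n} → absSI (pos w j) ≡ absSI (pos w j′) → j ≡ j′
  absSI-pos-injective (v , distinct) {j} {j′} = fromDoes (Fin.all? _) distinct j j′

  absSI-act-injective : (w : W n) {a b : SI n} →
                        absSI (act w a) ≡ absSI (act w b) → a ≡ b ⊎ a ≡ bar b
  absSI-act-injective w {a} {b} e =
    absSI-injective (absSI-pos-injective w (trans (sym (absSI-act w a)) (trans e (absSI-act w b))))

  act-injective : (w : W n) {a b : SI n} → act w a ≡ act w b → a ≡ b
  act-injective w {a} {b} e with absSI-act-injective w (cong absSI e)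
  ... | inj₁ a≡b  = a≡b
  ... | inj₂ refl = ⊥-elim (a≢bar-a (act w b) (trans (sym e) (act-bar w b)))

  pos-injective : (w : W n) {j j′ : Fin n} → pos w j ≡ pos w j′ → j ≡ j′
  pos-injective w {j} {j′} e with act-injective w {inj₁ j} {inj₁ j′} e
  ... | refl = refl

  pos≢bar-pos : (w : W n) (j j′ : Fin n) → pos w j ≢ bar (pos w j′)
  pos≢bar-pos w j j′ e with act-injective w {inj₁ j} {inj₂ j′} (trans e (sym (act-bar w (inj₁ j′))))
  ... | ()

  W-ext : {w w′ : W n} → (∀ j → pos w j ≡ pos w′ j) → w ≡ w′
  W-ext {w = v , d} {v′ , d′} e
    with refl ← trans (sym (Vec.tabulate∘lookup v))
                      (trans (Vec.tabulate-cong e) (Vec.tabulate∘lookup v′))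
    = cong (v ,_) (Bool.T-irrelevant d d′)

  mkW : (f : Fin n → SI n) → (∀ j j′ → absSI (f j) ≡ absSI (f j′) → j ≡ j′) → W n
  mkW f f-injective = tabulate f , toDoes (Fin.all? _) distinct
    where
    distinct = λ j j′ e → f-injective j j′ (trans (cong absSI (sym (Vec.lookup∘tabulate f j)))
                                                  (trans e (cong absSI (Vec.lookup∘tabulate f j′))))

  pos-mkW : ∀ f f-injective (j : Fin n) → pos (mkW f f-injective) j ≡ f j
  pos-mkW f _ j = Vec.lookup∘tabulate f j

  identityW : W n
  identityW = mkW inj₁ (λ _ _ e → e)

  injective⇒surjective : (g : Fin n → Fin n) → (∀ {x y} → g x ≡ g y → x ≡ y) → ∀ m → ∃[ j ] g j ≡ m
  injective⇒surjective {suc n} g g-injective m with Fin.any? (λ j → g j Fin.≟ m)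
  ... | yes hit = hit
  ... | no miss =
    let i , j , i<j , e = Fin.pigeonhole (ℕ.n<1+n n) (λ j → Fin.punchOut (≢m j))
    in ⊥-elim (Fin.<⇒≢ i<j (g-injective (Fin.punchOut-injective (≢m i) (≢m j) e)))
    where
    ≢m : ∀ j → m ≢ g j
    ≢m j = miss ∘ (j ,_) ∘ sym

  act-surjective : (w : W n) (b : SI n) → ∃[ a ] act w a ≡ b
  act-surjective w b with injective⇒surjective (absSI ∘ pos w) (absSI-pos-injective w) (absSI b)
  ... | j , e with absSI-injective e
  ...   | inj₁ e′ = inj₁ j , e′
  ...   | inj₂ e′ = inj₂ j , trans (cong bar e′) (bar-involutive b)

  precompose : (w : W n) (σ : SI n → SI n) → Involutive _≡_ σ → (∀ a → σ (bar a) ≡ bar (σ a)) →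
               ∃[ w′ ] (∀ a → act w′ a ≡ act w (σ a))
  precompose {n} w σ σ-involutive σ-bar = w′ , act-w′
    where
    σ-injective : ∀ {a b} → σ a ≡ σ b → a ≡ b
    σ-injective {a} {b} e = trans (sym (σ-involutive a)) (trans (cong σ e) (σ-involutive b))
    f : Fin n → SI n
    f j = act w (σ (inj₁ j))
    f-injective : ∀ j j′ → absSI (f j) ≡ absSI (f j′) → j ≡ j′
    f-injective j j′ e with absSI-act-injective w e
    ... | inj₁ e′ with σ-injective e′
    ...   | refl = refl
    f-injective j j′ e | inj₂ e′ with σ-injective (trans e′ (sym (σ-bar (inj₁ j′))))
    ...   | ()
    w′ = mkW f f-injective
    act-w′ : ∀ a → act w′ a ≡ act w (σ a)
    act-w′ (inj₁ j) = pos-mkW f f-injective j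
    act-w′ (inj₂ j) = trans (cong bar (pos-mkW f f-injective j))
                            (trans (sym (act-bar w (σ (inj₁ j)))) (cong (act w) (sym (σ-bar (inj₁ j)))))

  -- w′ = w s_k.  A record rather than a function type, so that with-abstractions over sPair k
  -- (on which sRef k computes) do not reach into it.
  record Step (k : Fin n) (w w′ : W n) : Set where
    constructor mkStep
    field
      acts : ∀ a → act w′ a ≡ act w (sRef k a)

  open Step public

  step-exists : (w : W n) (k : Fin n) → ∃ (Step k w)
  step-exists w k with w′ , acts′ ← precompose w (sRef k) (swapSI-involutive _ _) (swapSI-bar _ _) =
    w′ , mkStep acts′

  Step-sym : {k : Fin n} {w w′ : W n} → Step k w w′ → Step k w′ w
  Step-sym {k = k} {w} st = mkStep λ a →
    trans (cong (act w) (sym (swapSI-involutive _ _ a))) (sym (acts st (sRef k a)))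

  _⁺ : {k : Fin n} → suc (toℕ k) ℕ.< n → Fin n
  k<n ⁺ = fromℕ< k<n

  toℕ-⁺ : {k : Fin n} (k<n : suc (toℕ k) ℕ.< n) → toℕ (k<n ⁺) ≡ suc (toℕ k)
  toℕ-⁺ k<n = Fin.toℕ-fromℕ< k<n

  sPair-adjacent : (k : Fin n) (k<n : suc (toℕ k) ℕ.< n) → sPair k ≡ (inj₁ k , inj₁ (k<n ⁺))
  sPair-adjacent {n} k k<n with suc (toℕ k) ℕ.<? n
  ... | yes _   = refl
  ... | no k≮n = ⊥-elim (k≮n k<n)

  sPair-last : (k : Fin n) → ¬ suc (toℕ k) ℕ.< n → sPair k ≡ (inj₁ k , inj₂ k)
  sPair-last {n} k k≮n with suc (toℕ k) ℕ.<? n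
  ... | yes k<n = ⊥-elim (k≮n k<n)
  ... | no _    = refl

  sPair-fst : (k : Fin n) → proj₁ (sPair k) ≡ inj₁ k
  sPair-fst {n} k with suc (toℕ k) ℕ.<? n
  ... | yes _ = refl
  ... | no _  = refl

  module _ {k : Fin n} {w w′ : W n} (st : Step k w w′) where

    private
      sRef≡ : ∀ {p q} → sPair k ≡ (p , q) → ∀ a → sRef k a ≡ swapSI p q a
      sRef≡ e a = cong (λ pq → swapSI (proj₁ pq) (proj₂ pq) a) e

    step-adjacent : (k<n : suc (toℕ k) ℕ.< n) → ∀ j → pos w′ j ≡ pos w (transpose k (k<n ⁺) j)
    step-adjacent k<n j = trans (acts st (inj₁ j))
      (cong (act w) (trans (sRef≡ (sPair-adjacent k k<n) (inj₁ j)) (swapSI-inj₁ k (k<n ⁺) j)))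

    step-adjacent-here : (k<n : suc (toℕ k) ℕ.< n) → pos w′ k ≡ pos w (k<n ⁺)
    step-adjacent-here k<n = trans (step-adjacent k<n k) (cong (pos w) (transpose-matchˡ k (k<n ⁺)))

    step-adjacent-next : (k<n : suc (toℕ k) ℕ.< n) → pos w′ (k<n ⁺) ≡ pos w k
    step-adjacent-next k<n = trans (step-adjacent k<n (k<n ⁺)) (cong (pos w) (transpose-matchʳ k (k<n ⁺)))

    step-last-here : ¬ suc (toℕ k) ℕ.< n → pos w′ k ≡ bar (pos w k)
    step-last-here k≮n = trans (acts st (inj₁ k))
      (cong (act w) (trans (sRef≡ (sPair-last k k≮n) (inj₁ k)) (swapSI-p (inj₁ k) (inj₂ k))))

    step-last-other : ¬ suc (toℕ k) ℕ.< n → ∀ {j} → j ≢ k → pos w′ j ≡ pos w j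
    step-last-other k≮n {j} j≢k = trans (acts st (inj₁ j))
      (cong (act w) (trans (sRef≡ (sPair-last k k≮n) (inj₁ j))
                           (swapSI-other (inj₁ k) (inj₂ k) {inj₁ j} j≢k′ (λ ()) (λ ()) j≢k′)))
      where
      j≢k′ : inj₁ j ≢ inj₁ k
      j≢k′ = j≢k ∘ cong absSI

    step-sPair : act w (proj₁ (sPair k)) ≡ pos w k × act w (proj₂ (sPair k)) ≡ pos w′ k
    step-sPair = cong (act w) (sPair-fst k) , sym (trans (acts st (inj₁ k)) (cong (act w) sRef-k))
      where
      sRef-k : sRef k (inj₁ k) ≡ proj₂ (sPair k)
      sRef-k = subst (λ p → swapSI (proj₁ (sPair k)) (proj₂ (sPair k)) p ≡ proj₂ (sPair k))
                     (sPair-fst k) (swapSI-p (proj₁ (sPair k)) (proj₂ (sPair k)))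

  last-max : {k : Fin n} → ¬ suc (toℕ k) ℕ.< n → (j : Fin n) → toℕ j ℕ.≤ toℕ k
  last-max k≮n j = ℕ.s≤s⁻¹ (ℕ.≤-trans (Fin.toℕ<n j) (ℕ.≮⇒≥ k≮n))

  step-fixes : {k : Fin n} {w w′ : W n} → Step k w w′ →
               ∀ {j} → toℕ j ≢ toℕ k → toℕ j ≢ suc (toℕ k) → pos w′ j ≡ pos w j
  step-fixes {n} {k} {w} st {j} j≢k j≢k+1 with suc (toℕ k) ℕ.<? n
  ... | yes k<n = trans (step-adjacent st k<n j) (cong (pos w) (transpose-other (j≢k ∘ cong toℕ) j≢k⁺))
    where
    j≢k⁺ : j ≢ k<n ⁺
    j≢k⁺ e = j≢k+1 (trans (cong toℕ e) (toℕ-⁺ k<n))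
  ... | no k≮n = step-last-other st k≮n (j≢k ∘ cong toℕ)

  transpose-adjacent-≤ : {k i j : Fin n} (k<n : suc (toℕ k) ℕ.< n) → k ≢ i →
                         toℕ j ℕ.≤ toℕ i → toℕ (transpose k (k<n ⁺) j) ℕ.≤ toℕ i
  transpose-adjacent-≤ {k = k} {i} {j} k<n k≢i j≤i with transposeCase k (k<n ⁺) j
  ... | at-i refl rewrite transpose-matchˡ j (k<n ⁺) | toℕ-⁺ k<n =
    ℕ.≤∧≢⇒< j≤i (k≢i ∘ Fin.toℕ-injective)
  ... | at-j _ refl rewrite transpose-matchʳ k (k<n ⁺) =
    ℕ.≤-trans (ℕ.≤-trans (ℕ.n≤1+n _) (ℕ.≤-reflexive (sym (toℕ-⁺ k<n)))) j≤i
  ... | elsewhere j≢k j≢k⁺ rewrite transpose-other j≢k j≢k⁺ = j≤i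

  ∈-tabulate-does : {P : Fin m → Set} (P? : ∀ x → Dec (P x)) {x : Fin m} →
                    x ∈ tabulate (λ y → does (P? y)) ⇔ P x
  ∈-tabulate-does P? {x} = mk⇔
    (λ x∈ → fromDoes (P? x)
              (from Bool.T-≡ (trans (sym (Vec.lookup∘tabulate _ x)) (Vec.[]=⇒lookup x∈))))
    (λ Px → Vec.lookup⇒[]= x _ (trans (Vec.lookup∘tabulate _ x) (to Bool.T-≡ (toDoes (P? x) Px))))

  x∉p-x : (p : Subset m) (x : Fin m) → x ∉ p - x
  x∉p-x (_ ∷ _) Fin.zero    ()
  x∉p-x (_ ∷ p) (Fin.suc x) (there x∈p-x) = x∉p-x p x x∈p-x

  ∣p∣≡1+∣p-x∣ : {p : Subset m} {x : Fin m} → x ∈ p → ∣ p ∣ ≡ suc ∣ p - x ∣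
  ∣p∣≡1+∣p-x∣ {p = true ∷ p} here = cong (suc ∘ ∣_∣) (sym (p─⊥≡p p))
  ∣p∣≡1+∣p-x∣ {p = true ∷ p}  (there x∈p) = cong suc (∣p∣≡1+∣p-x∣ x∈p)
  ∣p∣≡1+∣p-x∣ {p = false ∷ p} (there x∈p) = ∣p∣≡1+∣p-x∣ x∈p

  ∣p∣≡1+t⇒nonempty : (p : Subset m) {t : ℕ} → ∣ p ∣ ≡ suc t → Nonempty p
  ∣p∣≡1+t⇒nonempty {m} p e with nonempty? p
  ... | yes p≠∅ = p≠∅
  ... | no p=∅ with () ← trans (sym e) (trans (cong ∣_∣ (Empty-unique p=∅)) (∣⊥∣≡0 m))

  ⊆-toF : {A B : Subset (n ℕ.+ n)} → (∀ a → toF a ∈ A → toF a ∈ B) → A ⊆ B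
  ⊆-toF {n} {A} {B} A⊆B {x} x∈A = subst (_∈ B) x≡a (A⊆B (splitAt n x) (subst (_∈ A) (sym x≡a) x∈A))
    where x≡a = Fin.join-splitAt n n x

  Among : ℕ → W n → SI n → Set
  Among t w a = ∃[ j ] toℕ j ℕ.< t × pos w j ≡ a

  record Enumerates (t : ℕ) (w : W n) (A : Subset (n ℕ.+ n)) : Set where
    constructor mkEnumerates
    field
      members : ∀ a → toF a ∈ A ⇔ Among t w a

  open Enumerates

  Enumerates-unique : ∀ {t} {w : W n} {A B} → Enumerates t w A → Enumerates t w B → A ≡ B
  Enumerates-unique A≅ B≅ =
    ⊆-antisym (⊆-toF λ a → from (members B≅ a) ∘ to (members A≅ a))
              (⊆-toF λ a → from (members A≅ a) ∘ to (members B≅ a))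

  Enumerates-unbalanced : ∀ {t} {w : W n} {A} → Enumerates t w A → Unbalanced {n} A
  Enumerates-unbalanced {w = w} A≅ a a∈A ā∈A
    with j , _ , refl ← to (members A≅ a) a∈A | j′ , _ , e ← to (members A≅ (bar a)) ā∈A
    = pos≢bar-pos w j′ j e

  Enumerates-count : ∀ {t} {w : W n} {A} → t ℕ.≤ n → Enumerates t w A → ∣ A ∣ ≡ t
  Enumerates-count {n} {zero} {w} {A} _ A≅ =
    trans (cong ∣_∣ (Empty-unique λ (x , x∈A) →
             nothing-below-0 (to (members A≅ (splitAt n x)) (toF-splitAt x∈A))))
          (∣⊥∣≡0 (n ℕ.+ n))
    where
    nothing-below-0 : ∀ {a} → ¬ Among 0 w a
    nothing-below-0 (_ , () , _)
    toF-splitAt : ∀ {x} → x ∈ A → toF (splitAt n x) ∈ A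
    toF-splitAt {x} = subst (_∈ A) (sym (Fin.join-splitAt n n x))
  Enumerates-count {n} {suc t} {w} {A} t<n A≅ =
    trans (∣p∣≡1+∣p-x∣ (from (members A≅ (pos w q)) (q , s≤s (ℕ.≤-reflexive q≡t) , refl)))
          (cong suc (Enumerates-count {w = w} (ℕ.<⇒≤ t<n) A-x≅))
    where
    q = fromℕ< t<n
    q≡t = Fin.toℕ-fromℕ< t<n
    A-x≅ : Enumerates t w (A - toF (pos w q))
    A-x≅ = mkEnumerates λ a → mk⇔ (to′ a) (from′ a)
      where
      to′ : ∀ a → toF a ∈ A - toF (pos w q) → Among t w a
      to′ a a∈ with to (members A≅ a) (p─q⊆p A _ a∈)
      ... | j , j≤t , refl with toℕ j ℕ.≟ t
      ...   | no j≢t = j , ℕ.≤∧≢⇒< (ℕ.s≤s⁻¹ j≤t) j≢t , refl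
      ...   | yes j≡t with refl ← Fin.toℕ-injective (trans j≡t (sym q≡t)) = ⊥-elim (x∉p-x A _ a∈)
      from′ : ∀ a → Among t w a → toF a ∈ A - toF (pos w q)
      from′ _ (j , j<t , refl) = x∈p∧x≢y⇒x∈p-y (from (members A≅ _) (j , ℕ.m<n⇒m<1+n j<t , refl))
        (λ e → ℕ.<-irrefl (trans (cong toℕ (pos-injective w (toF-injective e))) q≡t) j<t)

  place : ∀ {t} {w′ : W n} {A′} → Enumerates t w′ A′ →
          (q : Fin n) → toℕ q ≡ t → (a : SI n) → toF a ∉ A′ → toF (bar a) ∉ A′ →
          ∃[ w ] pos w q ≡ a × (∀ j → toℕ j ℕ.< t → pos w j ≡ pos w′ j)
  place {n} {t} {w′} {A′} A′≅ q q≡t a a∉A′ ā∉A′ = w , w-q , w-below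
    where
    b = proj₁ (act-surjective w′ a)
    b↦a = proj₂ (act-surjective w′ a)
    w+ = precompose w′ (swapSI (inj₁ q) b) (swapSI-involutive _ _) (swapSI-bar _ _)
    w = proj₁ w+
    w-q : pos w q ≡ a
    w-q = trans (proj₂ w+ (inj₁ q)) (trans (cong (act w′) (swapSI-p (inj₁ q) b)) b↦a)
    w-below : ∀ j → toℕ j ℕ.< t → pos w j ≡ pos w′ j
    w-below j j<t =
      trans (proj₂ w+ (inj₁ j)) (cong (act w′) (swapSI-other (inj₁ q) b {inj₁ j} j≢q j≢b (λ ()) j≢b̄))
      where
      j∈A′ : ∀ {c} → pos w′ j ≡ c → toF c ∈ A′
      j∈A′ refl = from (members A′≅ _) (j , j<t , refl)
      j≢q : inj₁ j ≢ inj₁ q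
      j≢q refl = ℕ.<-irrefl q≡t j<t
      j≢b : inj₁ j ≢ b
      j≢b e = a∉A′ (j∈A′ (trans (cong (act w′) e) b↦a))
      j≢b̄ : inj₁ j ≢ bar b
      j≢b̄ e = ā∉A′ (j∈A′ (trans (cong (act w′) e) (trans (act-bar w′ b) (cong bar b↦a))))

  enumerates-insert : ∀ {t} {w′ : W n} {A : Subset (n ℕ.+ n)} {a : SI n} → t ℕ.< n →
                      Unbalanced {n} A → toF a ∈ A → Enumerates t w′ (A - toF a) →
                      ∃[ w ] Enumerates (suc t) w A
  enumerates-insert {n} {t} {w′} {A} {a} t<n A-unbalanced a∈A A′≅ =
    w , mkEnumerates λ c → mk⇔ (to′ c) (from′ c)
    where
    q : Fin n
    q = fromℕ< t<n
    q≡t : toℕ q ≡ t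
    q≡t = Fin.toℕ-fromℕ< t<n
    placed : ∃[ w ] pos w q ≡ a × (∀ j → toℕ j ℕ.< t → pos w j ≡ pos w′ j)
    placed = place A′≅ q q≡t a (x∉p-x A (toF a)) (λ ā∈A′ → A-unbalanced a a∈A (p─q⊆p A _ ā∈A′))
    w : W n
    w = proj₁ placed
    w-q : pos w q ≡ a
    w-q = proj₁ (proj₂ placed)
    w-below : ∀ j → toℕ j ℕ.< t → pos w j ≡ pos w′ j
    w-below = proj₂ (proj₂ placed)
    to′ : ∀ c → toF c ∈ A → Among (suc t) w c
    to′ c c∈A with c ≟SI a
    ... | yes refl = q , s≤s (ℕ.≤-reflexive q≡t) , w-q
    ... | no c≢a with j , j<t , refl ← to (members A′≅ c) (x∈p∧x≢y⇒x∈p-y c∈A (c≢a ∘ toF-injective)) =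
      j , ℕ.m<n⇒m<1+n j<t , w-below j j<t
    from′ : ∀ c → Among (suc t) w c → toF c ∈ A
    from′ _ (j , j≤t , refl) with toℕ j ℕ.≟ t
    ... | yes j≡t with refl ← Fin.toℕ-injective (trans j≡t (sym q≡t)) =
      subst (λ c → toF c ∈ A) (sym w-q) a∈A
    ... | no j≢t = p─q⊆p A _ (subst (λ c → toF c ∈ A - toF a) (sym (w-below j j<t))
                                    (from (members A′≅ _) (j , j<t , refl)))
      where
      j<t : toℕ j ℕ.< t
      j<t = ℕ.≤∧≢⇒< (ℕ.s≤s⁻¹ j≤t) j≢t

  enumerates-exists : ∀ {t} {A : Subset (n ℕ.+ n)} → t ℕ.≤ n → Unbalanced {n} A → ∣ A ∣ ≡ t →
                      ∃[ w ] Enumerates t w A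
  enumerates-exists {n} {zero} {A} _ _ ∣A∣≡0 = identityW , mkEnumerates λ a → mk⇔
    (λ a∈A → ⊥-elim (ℕ.0≢1+n (trans (sym ∣A∣≡0) (∣p∣≡1+∣p-x∣ a∈A))))
    (λ { (_ , () , _) })
  enumerates-exists {n} {suc t} {A} t<n A-unbalanced ∣A∣≡1+t
    with x , x∈A ← ∣p∣≡1+t⇒nonempty A ∣A∣≡1+t
    with splitAt n x | Fin.join-splitAt n n x
  ... | a | refl
    with w′ , A-a≅ ← enumerates-exists {A = A - toF a} (ℕ.<⇒≤ t<n)
                       (λ b b∈ b̄∈ → A-unbalanced b (p─q⊆p A _ b∈) (p─q⊆p A _ b̄∈))
                       (ℕ.suc-injective (trans (sym (∣p∣≡1+∣p-x∣ x∈A)) ∣A∣≡1+t))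
    = enumerates-insert {a = a} t<n A-unbalanced x∈A A-a≅

  image-enumerates : (w : W n) (i : Fin n) → Enumerates (suc (toℕ i)) w (image w i)
  image-enumerates w i = mkEnumerates λ a → mk⇔
    (λ a∈ → let j , j≤i , e = to (∈-tabulate-does P?) a∈ in j , s≤s j≤i , toF-injective e)
    (λ { (j , s≤s j≤i , refl) → from (∈-tabulate-does P?) (j , j≤i , refl) })
    where
    P? = λ m → Fin.any? λ j → (j Fin.≤? i) ×-dec (toF (pos w j) Fin.≟ m)

  image-valid : (w : W n) (i : Fin n) → Valid i (image w i)
  image-valid w i = Enumerates-unbalanced {w = w} (image-enumerates w i) ,
                    Enumerates-count {w = w} (Fin.toℕ<n i) (image-enumerates w i)

  image-surjective : {i : Fin n} {A : Subset (n ℕ.+ n)} → Valid i A → ∃[ w ] image w i ≡ A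
  image-surjective {i = i} {A} (A-unbalanced , ∣A∣≡1+i)
    with w , A≅ ← enumerates-exists {A = A} (Fin.toℕ<n i) A-unbalanced ∣A∣≡1+i
    = w , Enumerates-unique {w = w} (image-enumerates w i) A≅

  Among-step : {k i : Fin n} {w w′ : W n} → Step k w w′ → k ≢ i →
               ∀ {a} → Among (suc (toℕ i)) w a → Among (suc (toℕ i)) w′ a
  Among-step {n} {k} {i} st k≢i (j , s≤s j≤i , refl) with suc (toℕ k) ℕ.<? n
  ... | yes k<n = transpose k (k<n ⁺) j , s≤s (transpose-adjacent-≤ k<n k≢i j≤i) ,
                  sym (step-adjacent {k = k} (Step-sym {k = k} st) k<n j)
  ... | no k≮n = j , s≤s j≤i , step-last-other {k = k} st k≮n j≢k
    where
    j≢k : j ≢ k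
    j≢k refl = k≢i (Fin.toℕ-injective (ℕ.≤-antisym j≤i (last-max k≮n i)))

  image-step : {k i : Fin n} {w w′ : W n} → Step k w w′ → k ≢ i → image w i ≡ image w′ i
  image-step {i = i} {w} {w′} st k≢i =
    Enumerates-unique (image-enumerates w i) (mkEnumerates λ a → mk⇔
      (Among-step (Step-sym st) k≢i ∘ to (members (image-enumerates w′ i) a))
      (from (members (image-enumerates w′ i) a) ∘ Among-step st k≢i))

  image-step-self : {i : Fin n} {w w′ : W n} → Step i w w′ → image w i ≢ image w′ i
  image-step-self {n} {i} {w} {w′} st e
    with j , s≤s j≤i , wj≡w′i ← to (members (image-enumerates w i) (pos w′ i))
           (subst (toF (pos w′ i) ∈_) (sym e)
                  (from (members (image-enumerates w′ i) _) (i , ℕ.≤-refl , refl)))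
       | suc (toℕ i) ℕ.<? n
  ... | yes i<n with refl ← pos-injective w (trans wj≡w′i (step-adjacent-here st i<n))
    = ℕ.<-irrefl refl (ℕ.≤-trans (ℕ.≤-reflexive (sym (toℕ-⁺ i<n))) j≤i)
  ... | no i≮n = pos≢bar-pos w j i (trans wj≡w′i (step-last-here st i≮n))

  -- The fibres of w ↦ w([i]) are connected by the s_k, k ≠ i

  ParabolicStep : Fin n → W n → W n → Set
  ParabolicStep i w w′ = ∃[ k ] k ≢ i × Step k w w′

  _∼[_]_ : W n → Fin n → W n → Set
  w ∼[ i ] w′ = Star (ParabolicStep i) w w′

  ∼-image : {i : Fin n} {w w′ : W n} → w ∼[ i ] w′ → image w i ≡ image w′ i
  ∼-image ε                     = refl
  ∼-image ((_ , k≢i , st) ◅ ss) = trans (image-step st k≢i) (∼-image ss)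

  AgreeBelow : ℕ → W n → W n → Set
  AgreeBelow t w w′ = ∀ j → toℕ j ℕ.< t → pos w j ≡ pos w′ j

  _∉[_,_⟩ : ℕ → ℕ → ℕ → Set
  i ∉[ a , b ⟩ = i ℕ.< a ⊎ b ℕ.≤ i

  ∉⇒≢ : {k i : Fin n} {a b : ℕ} → toℕ i ∉[ a , b ⟩ → a ℕ.≤ toℕ k → toℕ k ℕ.< b → k ≢ i
  ∉⇒≢ (inj₁ i<a) a≤k _ refl = ℕ.<⇒≱ i<a a≤k
  ∉⇒≢ (inj₂ b≤i) _ k<b refl = ℕ.<⇒≱ k<b b≤i

  lastFin : Fin n → Fin n
  lastFin {suc m} _ = Fin.fromℕ m

  lastFin-last : (q : Fin n) → ¬ suc (toℕ (lastFin q)) ℕ.< n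
  lastFin-last {suc m} _ rewrite Fin.toℕ-fromℕ m = ℕ.<-irrefl refl

  module _ {i : Fin n} where

    adjacent-step : (k : Fin n) (k<n : suc (toℕ k) ℕ.< n) → k ≢ i → (w : W n) →
                    ∃[ w′ ] w ∼[ i ] w′ × (∀ j → pos w′ j ≡ pos w (transpose k (k<n ⁺) j))
    adjacent-step k k<n k≢i w with w′ , st ← step-exists w k =
      w′ , (k , k≢i , st) ◅ ε , step-adjacent {k = k} {w} st k<n

    flip-step : (k : Fin n) → ¬ suc (toℕ k) ℕ.< n → k ≢ i → (w : W n) →
                ∃[ w′ ] w ∼[ i ] w′ × pos w′ k ≡ bar (pos w k) ×
                        (∀ {j} → j ≢ k → pos w′ j ≡ pos w j)
    flip-step k k≮n k≢i w with w′ , st ← step-exists w k =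
      w′ , (k , k≢i , st) ◅ ε , step-last-here {k = k} {w} st k≮n ,
      step-last-other {k = k} {w} st k≮n

    move-down : ∀ d {q p : Fin n} → toℕ p ≡ d ℕ.+ toℕ q → toℕ i ∉[ toℕ q , toℕ p ⟩ → (w : W n) →
                ∃[ w′ ] w ∼[ i ] w′ × pos w′ q ≡ pos w p × AgreeBelow (toℕ q) w′ w
    move-down zero p≡q _ w = w , ε , cong (pos w) (Fin.toℕ-injective (sym p≡q)) , λ _ _ → refl
    move-down (suc d) {q} {p} p≡ i∉ w =
      let w₁ , w∼w₁ , w₁≗ = adjacent-step k k<n (∉⇒≢ i∉ q≤k k<p) w
          w₂ , w₁∼w₂ , w₂q , w₂≗ = move-down d {q} {k} k≡ (Data.Sum.map₂ (ℕ.≤-trans (ℕ.<⇒≤ k<p)) i∉) w₁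
      in w₂ , w∼w₁ ◅◅ w₁∼w₂ ,
         trans w₂q (trans (w₁≗ k) (cong (pos w) (trans (transpose-matchˡ k (k<n ⁺)) k⁺≡p))) ,
         λ j j<q → trans (w₂≗ j j<q)
                         (trans (w₁≗ j) (cong (pos w) (transpose-other (j≢k j<q) (j≢k⁺ j<q))))
      where
      k<n′ : d ℕ.+ toℕ q ℕ.< n
      k<n′ = ℕ.<-trans (ℕ.n<1+n _) (subst (ℕ._< n) p≡ (Fin.toℕ<n p))
      k : Fin n
      k = fromℕ< k<n′
      k≡ : toℕ k ≡ d ℕ.+ toℕ q
      k≡ = Fin.toℕ-fromℕ< k<n′
      q≤k : toℕ q ℕ.≤ toℕ k
      q≤k = subst (toℕ q ℕ.≤_) (sym k≡) (ℕ.m≤n+m _ d)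
      k<p : toℕ k ℕ.< toℕ p
      k<p = subst₂ ℕ._<_ (sym k≡) (sym p≡) (ℕ.n<1+n _)
      k<n : suc (toℕ k) ℕ.< n
      k<n = ℕ.<-≤-trans (s≤s k<p) (Fin.toℕ<n p)
      k⁺≡p : k<n ⁺ ≡ p
      k⁺≡p = Fin.toℕ-injective (trans (toℕ-⁺ k<n) (trans (cong suc k≡) (sym p≡)))
      j≢k : ∀ {j} → toℕ j ℕ.< toℕ q → j ≢ k
      j≢k j<q refl = ℕ.<⇒≱ j<q q≤k
      j≢k⁺ : ∀ {j} → toℕ j ℕ.< toℕ q → j ≢ k<n ⁺
      j≢k⁺ j<q j≡k⁺ = ℕ.<-irrefl (cong toℕ (trans j≡k⁺ k⁺≡p)) (ℕ.<-trans j<q (ℕ.≤-<-trans q≤k k<p))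

    move-up : ∀ d {p q : Fin n} → toℕ q ≡ d ℕ.+ toℕ p → toℕ i ∉[ toℕ p , toℕ q ⟩ → (w : W n) →
              ∃[ w′ ] w ∼[ i ] w′ × pos w′ q ≡ pos w p × AgreeBelow (toℕ p) w′ w
    move-up zero q≡p _ w = w , ε , cong (pos w) (Fin.toℕ-injective q≡p) , λ _ _ → refl
    move-up (suc d) {p} {q} q≡ i∉ w =
      let w₁ , w∼w₁ , w₁≗ = adjacent-step p p<n (∉⇒≢ i∉ ℕ.≤-refl p<q) w
          w₂ , w₁∼w₂ , w₂q , w₂≗ = move-up d {p<n ⁺} {q} q≡′ (Data.Sum.map₁ (flip ℕ.<-trans p<p⁺) i∉) w₁
      in w₂ , w∼w₁ ◅◅ w₁∼w₂ ,
         trans w₂q (trans (w₁≗ (p<n ⁺)) (cong (pos w) (transpose-matchʳ p (p<n ⁺)))) ,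
         λ j j<p → trans (w₂≗ j (ℕ.<-trans j<p p<p⁺))
                         (trans (w₁≗ j) (cong (pos w) (transpose-other (j≢p j<p) (j≢p⁺ j<p))))
      where
      p<q : toℕ p ℕ.< toℕ q
      p<q = subst (toℕ p ℕ.<_) (sym q≡) (s≤s (ℕ.m≤n+m (toℕ p) d))
      p<n : suc (toℕ p) ℕ.< n
      p<n = ℕ.≤-<-trans p<q (Fin.toℕ<n q)
      p<p⁺ : toℕ p ℕ.< toℕ (p<n ⁺)
      p<p⁺ = ℕ.≤-reflexive (sym (toℕ-⁺ p<n))
      q≡′ : toℕ q ≡ d ℕ.+ toℕ (p<n ⁺)
      q≡′ = trans q≡ (trans (sym (ℕ.+-suc d (toℕ p))) (cong (d ℕ.+_) (sym (toℕ-⁺ p<n))))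
      j≢p : ∀ {j} → toℕ j ℕ.< toℕ p → j ≢ p
      j≢p j<p refl = ℕ.<-irrefl refl j<p
      j≢p⁺ : ∀ {j} → toℕ j ℕ.< toℕ p → j ≢ p<n ⁺
      j≢p⁺ j<p refl = ℕ.<-asym j<p p<p⁺

    -- Brings w′(q) to position q, moving it down from its position p ≥ q; if it occurs in w
    -- with the opposite sign (only possible for q > i), it goes through the last position first.
    fix-position : {w w′ : W n} (q : Fin n) → image w i ≡ image w′ i → AgreeBelow (toℕ q) w w′ →
                   ∃[ w₂ ] w ∼[ i ] w₂ × pos w₂ q ≡ pos w′ q × AgreeBelow (toℕ q) w₂ w
    fix-position {w} {w′} q same agree = from-source (proj₁ source) (proj₂ source)
      where
      b : SI n
      b = pos w′ q
      source : ∃[ a ] act w a ≡ b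
      source = act-surjective w b
      q≤source : ∀ {a} → act w a ≡ b → toℕ q ℕ.≤ toℕ (absSI a)
      q≤source {a} wa≡b = ℕ.≮⇒≥ λ p<q → ℕ.<-irrefl (cong toℕ (absSI-pos-injective w′
        (trans (cong absSI (sym (agree _ p<q))) (trans (sym (absSI-act w a)) (cong absSI wa≡b))))) p<q
      b-among : toℕ q ℕ.≤ toℕ i → Among (suc (toℕ i)) w b
      b-among q≤i = to (members (image-enumerates w i) b)
        (subst (toF b ∈_) (sym same) (from (members (image-enumerates w′ i) b) (q , s≤s q≤i , refl)))
      from-source : ∀ a → act w a ≡ b → ∃[ w₂ ] w ∼[ i ] w₂ × pos w₂ q ≡ b × AgreeBelow (toℕ q) w₂ w
      from-source (inj₁ p) wp≡b =
        let w₂ , w∼w₂ , w₂q , w₂≗ = move-down (toℕ p ℕ.∸ toℕ q) (sym (ℕ.m∸n+n≡m q≤p)) i∉ w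
        in w₂ , w∼w₂ , trans w₂q wp≡b , w₂≗
        where
        q≤p = q≤source {inj₁ p} wp≡b
        i∉ : toℕ i ∉[ toℕ q , toℕ p ⟩
        i∉ with toℕ q ℕ.≤? toℕ i
        ... | no q≰i = inj₁ (ℕ.≰⇒> q≰i)
        ... | yes q≤i with p′ , s≤s p′≤i , wp′≡b ← b-among q≤i
                      with refl ← pos-injective w (trans wp′≡b (sym wp≡b)) = inj₂ p′≤i
      from-source (inj₂ p) w̄p≡b =
        let w₁ , w∼w₁ , w₁L , w₁≗ = move-up (toℕ L ℕ.∸ toℕ p) {p} {L} (sym (ℕ.m∸n+n≡m p≤L))
                                             (inj₁ (ℕ.<-≤-trans i<q q≤p)) w
            w₂ , w₁∼w₂ , w₂L , w₂≗ = flip-step L L-last (λ { refl → ℕ.<⇒≱ i<q q≤L }) w₁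
            w₃ , w₂∼w₃ , w₃q , w₃≗ = move-down (toℕ L ℕ.∸ toℕ q) {q} {L} (sym (ℕ.m∸n+n≡m q≤L))
                                               (inj₁ i<q) w₂
        in w₃ , w∼w₁ ◅◅ w₁∼w₂ ◅◅ w₂∼w₃ ,
           trans w₃q (trans w₂L (trans (cong bar w₁L) w̄p≡b)) ,
           λ j j<q → trans (w₃≗ j j<q)
                           (trans (w₂≗ λ { refl → ℕ.<⇒≱ j<q q≤L }) (w₁≗ j (ℕ.<-≤-trans j<q q≤p)))
        where
        L = lastFin q
        L-last = lastFin-last q
        q≤L = last-max L-last q
        p≤L = last-max L-last p
        q≤p = q≤source {inj₂ p} w̄p≡b
        i<q : toℕ i ℕ.< toℕ q
        i<q = ℕ.≰⇒> λ q≤i → let p′ , _ , wp′≡b = b-among q≤i in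
                              pos≢bar-pos w p′ p (trans wp′≡b (sym w̄p≡b))

    image-fibre-connected : {w w′ : W n} → image w i ≡ image w′ i → w ∼[ i ] w′
    image-fibre-connected {w} {w′} same =
      let w₂ , w∼w₂ , w₂≗w′ = sorted n ℕ.≤-refl
      in subst (w ∼[ i ]_) (W-ext λ j → w₂≗w′ j (Fin.toℕ<n j)) w∼w₂
      where
      sorted : ∀ t → t ℕ.≤ n → ∃[ w₂ ] w ∼[ i ] w₂ × AgreeBelow t w₂ w′
      sorted zero _ = w , ε , λ _ ()
      sorted (suc t) t<n =
        let w₂ , w₁∼w₂ , w₂q , w₂≗w₁ = fix-position {w₁} {w′} q (trans (sym (∼-image w∼w₁)) same) agree₁
        in w₂ , w∼w₁ ◅◅ w₁∼w₂ , λ j j≤t → agree {w₂} w₂q w₂≗w₁ j (ℕ.s≤s⁻¹ j≤t)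
        where
        previous = sorted t (ℕ.<⇒≤ t<n)
        w₁ = proj₁ previous
        w∼w₁ = proj₁ (proj₂ previous)
        q = fromℕ< t<n
        q≡t = Fin.toℕ-fromℕ< t<n
        agree₁ : AgreeBelow (toℕ q) w₁ w′
        agree₁ j j<q = proj₂ (proj₂ previous) j (subst (toℕ j ℕ.<_) q≡t j<q)
        agree : ∀ {w₂} → pos w₂ q ≡ pos w′ q → AgreeBelow (toℕ q) w₂ w₁ →
                ∀ j → toℕ j ℕ.≤ t → pos w₂ j ≡ pos w′ j
        agree w₂q w₂≗w₁ j j≤t with toℕ j ℕ.≟ t
        ... | yes j≡t with refl ← Fin.toℕ-injective (trans j≡t (sym q≡t)) = w₂q
        ... | no j≢t = trans (w₂≗w₁ j j<q) (agree₁ j j<q)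
          where j<q = subst (toℕ j ℕ.<_) (sym q≡t) (ℕ.≤∧≢⇒< j≤t j≢t)

open Hyperoctahedral

module Summation {c ℓ} (R : CommutativeRing c ℓ) where

  open CommutativeRing R
  open import Algebra.Properties.Ring ring public
    using ( -0#≈0#; -‿involutive; -1*x≈-x; -‿distribʳ-*; x[y-z]≈xy-xz; [y-z]x≈yx-zx
          ; ⁻¹-anti-homo‿-; x∙y⁻¹≈ε⇒x≈y )
  open import Algebra.Properties.CommutativeSemigroup +-commutativeSemigroup using (interchange)
  open import Algebra.Properties.CommutativeSemigroup *-commutativeSemigroup public using (x∙yz≈y∙xz)
  open import Algebra.Properties.Semiring.Sum semiring public
  open import Relation.Binary.Reasoning.Setoid setoid

  x-0≈x : ∀ x → x - 0# ≈ x
  x-0≈x x = trans (+-congˡ -0#≈0#) (+-identityʳ x)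

  x-y≈0⇒x≈y : ∀ {x y} → x - y ≈ 0# → x ≈ y
  x-y≈0⇒x≈y = x∙y⁻¹≈ε⇒x≈y _ _

  [x-y]-[x-z]≈z-y : ∀ x y z → (x - y) - (x - z) ≈ z - y
  [x-y]-[x-z]≈z-y x y z = begin
    (x - y) - (x - z)    ≈⟨ +-congˡ (⁻¹-anti-homo‿- x z) ⟩
    (x - y) + (z - x)    ≈⟨ +-congˡ (+-comm z (- x)) ⟩
    (x - y) + (- x + z)  ≈⟨ interchange x (- y) (- x) z ⟩
    (x - x) + (- y + z)  ≈⟨ +-cong (-‿inverseʳ x) (+-comm (- y) z) ⟩
    0# + (z - y)         ≈⟨ +-identityˡ _ ⟩
    z - y                ∎

  [x-z]-[y-z]≈x-y : ∀ x y z → (x - z) - (y - z) ≈ x - y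
  [x-z]-[y-z]≈x-y x y z = begin
    (x - z) - (y - z)    ≈⟨ +-congˡ (⁻¹-anti-homo‿- y z) ⟩
    (x - z) + (z - y)    ≈⟨ +-assoc x (- z) (z - y) ⟩
    x + (- z + (z - y))  ≈⟨ +-congˡ (+-assoc (- z) z (- y)) ⟨
    x + ((- z + z) - y)  ≈⟨ +-congˡ (+-congʳ (-‿inverseˡ z)) ⟩
    x + (0# - y)         ≈⟨ +-congˡ (+-identityˡ (- y)) ⟩
    x - y                ∎

  δ : ∀ {P : Set} → Dec P → Carrier
  δ P? = if does P? then 1# else 0#

  δ-no : ∀ {P : Set} (P? : Dec P) → ¬ P → δ P? ≡ 0#
  δ-no P? ¬p rewrite dec-false P? ¬p = ≡.refl

  δ-≡ : ∀ {P Q : Set} (P? : Dec P) (Q? : Dec Q) → (P → Q) → (Q → P) → δ P? ≡ δ Q?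
  δ-≡ (yes _) (yes _) _   _   = ≡.refl
  δ-≡ (no _)  (no _)  _   _   = ≡.refl
  δ-≡ (yes p) (no ¬q) P⇒Q _   = ⊥-elim (¬q (P⇒Q p))
  δ-≡ (no ¬p) (yes q) _   Q⇒P = ⊥-elim (¬p (Q⇒P q))

  *-δ-yes : ∀ {P : Set} (P? : Dec P) → P → ∀ x → x * δ P? ≈ x
  *-δ-yes P? p x rewrite dec-true P? p = *-identityʳ x

  *-δ-no : ∀ {P : Set} (P? : Dec P) → ¬ P → ∀ x → x * δ P? ≈ 0#
  *-δ-no P? ¬p x rewrite dec-false P? ¬p = zeroʳ x

  ∑-zero : ∀ {n} (f : Fin n → Carrier) → (∀ i → f i ≈ 0#) → ∑[ i < n ] f i ≈ 0#
  ∑-zero {n} f f≈0 = trans (sum-cong-≋ f≈0) (sum-replicate-zero n)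

  ∑-single : ∀ {n} (f : Fin n → Carrier) (i : Fin n) → (∀ j → j ≢ i → f j ≈ 0#) →
             ∑[ j < n ] f j ≈ f i
  ∑-single {suc n} f i others≈0 = begin
    sum f                                ≈⟨ sum-remove {i = i} f ⟩
    f i + ∑[ j < n ] f (Fin.punchIn i j) ≈⟨ +-congˡ (∑-zero _ λ j → others≈0 _ (Fin.punchInᵢ≢i i j)) ⟩
    f i + 0#                             ≈⟨ +-identityʳ (f i) ⟩
    f i                                  ∎

  ∑-neg : ∀ {n} (f : Fin n → Carrier) → ∑[ i < n ] (- f i) ≈ - ∑[ i < n ] f i
  ∑-neg f = begin
    ∑[ i < _ ] (- f i)        ≈⟨ sum-cong-≋ (λ i → -1*x≈-x (f i)) ⟨
    ∑[ i < _ ] (- 1# * f i)   ≈⟨ *-distribˡ-sum (- 1#) f ⟨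
    - 1# * sum f              ≈⟨ -1*x≈-x (sum f) ⟩
    - sum f                   ∎

  ∑-distrib-‿- : ∀ {n} (f g : Fin n → Carrier) →
                 ∑[ i < n ] (f i - g i) ≈ ∑[ i < n ] f i - ∑[ i < n ] g i
  ∑-distrib-‿- f g = trans (∑-distrib-+ f (λ i → - g i)) (+-congˡ (∑-neg g))

  ∑-δ : ∀ {n} (c : Fin n → Carrier) (j : Fin n) → ∑[ i < n ] (c i * δ (i Fin.≟ j)) ≈ c j
  ∑-δ c j = trans (∑-single _ j (λ i i≢j → *-δ-no (i Fin.≟ j) i≢j (c i)))
                  (*-δ-yes (j Fin.≟ j) ≡.refl (c j))

  -- c(j - 1), with c(-1) = 0
  prev : ∀ {n} → (Fin n → Carrier) → Fin n → Carrier
  prev c Fin.zero    = 0#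
  prev c (Fin.suc j) = c (inject₁ j)

  ∑-δ-suc : ∀ {n} (c : Fin n → Carrier) (j : Fin n) →
            ∑[ i < n ] (c i * δ (suc (toℕ i) ℕ.≟ toℕ j)) ≈ prev c j
  ∑-δ-suc c Fin.zero    = ∑-zero _ (λ i → *-δ-no (suc (toℕ i) ℕ.≟ 0) (λ ()) (c i))
  ∑-δ-suc c (Fin.suc j) = trans (∑-single _ (inject₁ j) others) (*-δ-yes (_ ℕ.≟ _) i≡j (c (inject₁ j)))
    where
    i≡j : suc (toℕ (inject₁ j)) ≡ toℕ (Fin.suc j)
    i≡j = ≡.cong suc (Fin.toℕ-inject₁ j)
    others : ∀ i → i ≢ inject₁ j → c i * δ (suc (toℕ i) ℕ.≟ toℕ (Fin.suc j)) ≈ 0#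
    others i i≢j = *-δ-no (_ ℕ.≟ _) (i≢j ∘ Fin.toℕ-injective ∘ below) (c i)
      where
      below : suc (toℕ i) ≡ toℕ (Fin.suc j) → toℕ i ≡ toℕ (inject₁ j)
      below e = ≡.trans (ℕ.suc-injective e) (≡.sym (Fin.toℕ-inject₁ j))

  sumL : ∀ {a} {A : Set a} → (A → Carrier) → List A → Carrier
  sumL g = List.foldr (λ x acc → g x + acc) 0#

  module _ {a} {A : Set a} where

    sumL-zero : ∀ (g : A → Carrier) xs → (∀ x → g x ≈ 0#) → sumL g xs ≈ 0#
    sumL-zero g []       g≈0 = refl
    sumL-zero g (x ∷ xs) g≈0 = trans (+-cong (g≈0 x) (sumL-zero g xs g≈0)) (+-identityʳ 0#)

    sumL-++ : ∀ (g : A → Carrier) xs ys → sumL g (xs ++ ys) ≈ sumL g xs + sumL g ys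
    sumL-++ g []       ys = sym (+-identityˡ _)
    sumL-++ g (x ∷ xs) ys = trans (+-congˡ (sumL-++ g xs ys)) (sym (+-assoc _ _ _))

    sumL-map : ∀ {b} {B : Set b} (g : A → Carrier) (f : B → A) xs →
               sumL g (List.map f xs) ≡ sumL (g ∘ f) xs
    sumL-map g f []       = ≡.refl
    sumL-map g f (x ∷ xs) = ≡.cong (g (f x) +_) (sumL-map g f xs)

    sumL-filter : ∀ {p} {P : Pred A p} (P? : Decidable P) (g : A → Carrier) xs →
                  sumL g (filter P? xs) ≈ sumL (λ x → if does (P? x) then g x else 0#) xs
    sumL-filter P? g []       = refl
    sumL-filter P? g (x ∷ xs) with does (P? x)
    ... | true  = +-congˡ (sumL-filter P? g xs)
    ... | false = trans (sumL-filter P? g xs) (sym (+-identityˡ _))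

  sumL-cartesianProduct : ∀ {a b} {A : Set a} {B : Set b} {t}
                          (f : Fin t → A) (ys : List B) (h : A × B → Carrier) →
                          sumL h (cartesianProduct (List.tabulate f) ys) ≈
                          ∑[ i < t ] sumL (λ y → h (f i , y)) ys
  sumL-cartesianProduct {t = zero}  f ys h = refl
  sumL-cartesianProduct {t = suc t} f ys h = begin
    sumL h (List.map (f Fin.zero ,_) ys ++ rest)     ≈⟨ sumL-++ h (List.map (f Fin.zero ,_) ys) rest ⟩
    sumL h (List.map (f Fin.zero ,_) ys) + sumL h rest
      ≈⟨ +-cong (reflexive (sumL-map h (f Fin.zero ,_) ys)) (sumL-cartesianProduct (f ∘ Fin.suc) ys h) ⟩
    ∑[ i < suc t ] sumL (λ y → h (f i , y)) ys      ∎
    where rest = cartesianProduct (List.tabulate (f ∘ Fin.suc)) ys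

  sumL-allSubsets : ∀ {m} (g : Subset m → Carrier) (B : Subset m) → (∀ A → A ≢ B → g A ≈ 0#) →
                    sumL g (allSubsets m) ≈ g B
  sumL-allSubsets {zero}  g []      _     = +-identityʳ (g [])
  sumL-allSubsets {suc m} g (b ∷ B) g≈0 = begin
    sumL g (List.map (true ∷_) subsets ++ List.map (false ∷_) subsets)
      ≈⟨ sumL-++ g (List.map (true ∷_) subsets) (List.map (false ∷_) subsets) ⟩
    sumL g (List.map (true ∷_) subsets) + sumL g (List.map (false ∷_) subsets)
      ≈⟨ +-cong (reflexive (sumL-map g (true ∷_) subsets)) (reflexive (sumL-map g (false ∷_) subsets)) ⟩
    sumL (g ∘ (true ∷_)) subsets + sumL (g ∘ (false ∷_)) subsets
      ≈⟨ split b g≈0 ⟩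
    g (b ∷ B) ∎
    where
    subsets = allSubsets m
    tail-≢ : ∀ {x y A} → A ≢ B → x ∷ A ≢ y ∷ B
    tail-≢ A≢B e = A≢B (Vec.∷-injectiveʳ e)
    split : ∀ y → (∀ A → A ≢ y ∷ B → g A ≈ 0#) →
            sumL (g ∘ (true ∷_)) subsets + sumL (g ∘ (false ∷_)) subsets ≈ g (y ∷ B)
    split true g≈0 = trans (+-cong (sumL-allSubsets (g ∘ (true ∷_)) B (λ A A≢B → g≈0 _ (tail-≢ A≢B)))
                                   (sumL-zero _ subsets (λ A → g≈0 _ λ ())))
                           (+-identityʳ _)
    split false g≈0 = trans (+-cong (sumL-zero _ subsets (λ A → g≈0 _ λ ()))
                                    (sumL-allSubsets (g ∘ (false ∷_)) B (λ A A≢B → g≈0 _ (tail-≢ A≢B))))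
                            (+-identityˡ _)

module LinearForms {f ℓ} (F : Field f ℓ) where

  open Field F
  open Summation commutativeRing
  open import Relation.Binary.Reasoning.Setoid setoid

  private
    variable
      n : ℕ

  sgn : SI n → Carrier
  sgn (inj₁ _) = 1#
  sgn (inj₂ _) = - 1#

  sgn²≈1 : (a : SI n) → sgn a * sgn a ≈ 1#
  sgn²≈1 (inj₁ _) = *-identityˡ 1#
  sgn²≈1 (inj₂ _) = trans (-1*x≈-x (- 1#)) (-‿involutive 1#)

  sgn-cancel : (a : SI n) {x y : Carrier} → sgn a * x ≈ sgn a * y → x ≈ y
  sgn-cancel a {x} {y} e = begin
    x                    ≈⟨ *-identityˡ x ⟨
    1# * x               ≈⟨ *-congʳ (sgn²≈1 a) ⟨
    (sgn a * sgn a) * x  ≈⟨ *-assoc _ _ _ ⟩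
    sgn a * (sgn a * x)  ≈⟨ *-congˡ e ⟩
    sgn a * (sgn a * y)  ≈⟨ *-assoc _ _ _ ⟨
    (sgn a * sgn a) * y  ≈⟨ *-congʳ (sgn²≈1 a) ⟩
    1# * y               ≈⟨ *-identityˡ y ⟩
    y                    ∎

  var-sgn : (a : SI n) (m : Fin n) → var F a m ≈ sgn a * δ (absSI a Fin.≟ m)
  var-sgn (inj₁ _) m = sym (*-identityˡ _)
  var-sgn (inj₂ _) m = sym (-1*x≈-x _)

  var-bar : (a : SI n) (m : Fin n) → var F (bar a) m ≈ - var F a m
  var-bar (inj₁ _) m = refl
  var-bar (inj₂ _) m = sym (-‿involutive _)

  -- for w′ = w s_k, the generator of the ideal in the condition defining 𝓜_Δ
  rootForm : W n → W n → Fin n → LF F n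
  rootForm w w′ k = _-L_ F (var F (pos w k)) (var F (pos w′ k))

  -- the coefficient of x_{w(j)} in L
  coord : W n → LF F n → Fin n → Carrier
  coord w L j = sgn (pos w j) * L (absSI (pos w j))

  coord-cong : (w : W n) {L L′ : LF F n} → (∀ m → L m ≈ L′ m) → ∀ j → coord w L j ≈ coord w L′ j
  coord-cong w L≈L′ j = *-congˡ (L≈L′ _)

  coord-sub : (w : W n) (L L′ : LF F n) (j : Fin n) →
              coord w (_-L_ F L L′) j ≈ coord w L j - coord w L′ j
  coord-sub w L L′ j = x[y-z]≈xy-xz _ _ _

  coord-∑ : (w : W n) (c : Fin n → Carrier) (G : Fin n → LF F n) (j : Fin n) →
            coord w (λ m → ∑[ i < n ] (c i * G i m)) j ≈ ∑[ i < n ] (c i * coord w (G i) j)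
  coord-∑ {n} w c G j =
    trans (*-distribˡ-sum s (λ i → c i * G i m)) (sum-cong-≋ λ i → x∙yz≈y∙xz s (c i) (G i m))
    where
    s = sgn (pos w j)
    m = absSI (pos w j)

  coord-var : (w : W n) (p j : Fin n) → coord w (var F (pos w p)) j ≈ δ (p Fin.≟ j)
  coord-var w p j = trans (*-congˡ (var-sgn (pos w p) _)) (by-cases (p Fin.≟ j))
    where
    |p|≟|j| = absSI (pos w p) Fin.≟ absSI (pos w j)
    by-cases : (p≟j : Dec (p ≡ j)) → sgn (pos w j) * (sgn (pos w p) * δ |p|≟|j|) ≈ δ p≟j
    by-cases (yes ≡.refl) = trans (*-congˡ (*-δ-yes |p|≟|j| ≡.refl _)) (sgn²≈1 (pos w p))
    by-cases (no p≢j) = trans (*-congˡ (*-δ-no |p|≟|j| (p≢j ∘ absSI-pos-injective w) _)) (zeroʳ _)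

  coord-injective : (w : W n) {L L′ : LF F n} → (∀ j → coord w L j ≈ coord w L′ j) →
                    ∀ m → L m ≈ L′ m
  coord-injective w {L} {L′} same m
    with j , ≡.refl ← injective⇒surjective (absSI ∘ pos w) (absSI-pos-injective w) m =
    sgn-cancel (pos w j) (same j)

  next : W n → Fin n → LF F n
  next {n} w i with suc (toℕ i) ℕ.<? n
  ... | yes i<n = var F (pos w (i<n ⁺))
  ... | no _    = zeroLF F

  fForm≈var-next : (w : W n) (i m : Fin n) → fForm F w i m ≈ var F (pos w i) m - next w i m
  fForm≈var-next {n} w i m with suc (toℕ i) ℕ.<? n
  ... | yes _ = refl
  ... | no _  = sym (x-0≈x _)

  next-adjacent : (w : W n) {i : Fin n} (i<n : suc (toℕ i) ℕ.< n) → next w i ≡ var F (pos w (i<n ⁺))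
  next-adjacent {n} w {i} i<n with suc (toℕ i) ℕ.<? n
  ... | yes _   = ≡.refl
  ... | no i≮n = ⊥-elim (i≮n i<n)

  next-last : (w : W n) {i : Fin n} → ¬ suc (toℕ i) ℕ.< n → next w i ≡ zeroLF F
  next-last {n} w {i} i≮n with suc (toℕ i) ℕ.<? n
  ... | yes i<n = ⊥-elim (i≮n i<n)
  ... | no _    = ≡.refl

  next-cong : {w w′ : W n} {i : Fin n} → (∀ i<n → pos w′ (i<n ⁺) ≡ pos w (i<n ⁺)) →
              next w′ i ≡ next w i
  next-cong {n} {w} {w′} {i} same with suc (toℕ i) ℕ.<? n
  ... | yes i<n = ≡.cong (var F) (same i<n)
  ... | no _    = ≡.refl

  coord-next : (w : W n) (i j : Fin n) → coord w (next w i) j ≈ δ (suc (toℕ i) ℕ.≟ toℕ j)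
  coord-next {n} w i j with suc (toℕ i) ℕ.<? n
  ... | yes i<n = trans (coord-var w (i<n ⁺) j) (reflexive (δ-≡ (Fin._≟_ _ j) (suc (toℕ i) ℕ.≟ toℕ j)
                    (λ e → ≡.trans (≡.sym (toℕ-⁺ i<n)) (≡.cong toℕ e))
                    (λ e → Fin.toℕ-injective (≡.trans (toℕ-⁺ i<n) e))))
  ... | no i≮n  = trans (zeroʳ _) (sym (reflexive (δ-no (suc (toℕ i) ℕ.≟ toℕ j)
                    (λ e → i≮n (≡.subst (ℕ._< n) (≡.sym e) (Fin.toℕ<n j))))))

  coord-fForm : (w : W n) (i j : Fin n) →
                coord w (fForm F w i) j ≈ δ (i Fin.≟ j) - δ (suc (toℕ i) ℕ.≟ toℕ j)
  coord-fForm w i j = begin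
    coord w (fForm F w i) j
      ≈⟨ coord-cong w (fForm≈var-next w i) j ⟩
    coord w (_-L_ F (var F (pos w i)) (next w i)) j
      ≈⟨ coord-sub w (var F (pos w i)) (next w i) j ⟩
    coord w (var F (pos w i)) j - coord w (next w i) j
      ≈⟨ +-cong (coord-var w i j) (-‿cong (coord-next w i j)) ⟩
    δ (i Fin.≟ j) - δ (suc (toℕ i) ℕ.≟ toℕ j) ∎

  coord-combination : (w : W n) (c : Fin n → Carrier) (j : Fin n) →
                      coord w (λ m → ∑[ i < n ] (c i * fForm F w i m)) j ≈ c j - prev c j
  coord-combination {n} w c j = begin
    coord w (λ m → ∑[ i < n ] (c i * fForm F w i m)) j
      ≈⟨ coord-∑ w c (fForm F w) j ⟩
    ∑[ i < n ] (c i * coord w (fForm F w i) j)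
      ≈⟨ sum-cong-≋ (λ i → trans (*-congˡ (coord-fForm w i j)) (x[y-z]≈xy-xz (c i) _ _)) ⟩
    ∑[ i < n ] (c i * δ (i Fin.≟ j) - c i * δ (suc (toℕ i) ℕ.≟ toℕ j))
      ≈⟨ ∑-distrib-‿- (λ i → c i * δ (i Fin.≟ j)) (λ i → c i * δ (suc (toℕ i) ℕ.≟ toℕ j)) ⟩
    ∑[ i < n ] (c i * δ (i Fin.≟ j)) - ∑[ i < n ] (c i * δ (suc (toℕ i) ℕ.≟ toℕ j))
      ≈⟨ +-cong (∑-δ c j) (-‿cong (∑-δ-suc c j)) ⟩
    c j - prev c j ∎

  Δ-zero : (c : Fin n → Carrier) → (∀ j → c j - prev c j ≈ 0#) → ∀ j → c j ≈ 0#
  Δ-zero {suc n} c Δc≈0 = <-weakInduction (λ j → c j ≈ 0#) c₀≈0 step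
    where
    c₀≈0 : c Fin.zero ≈ 0#
    c₀≈0 = trans (sym (x-0≈x (c Fin.zero))) (Δc≈0 Fin.zero)
    step : ∀ j → c (inject₁ j) ≈ 0# → c (Fin.suc j) ≈ 0#
    step j cj≈0 = trans (x-y≈0⇒x≈y (Δc≈0 (Fin.suc j))) cj≈0

  -- The functionals dual to f_1(w), …, f_n(w)

  Φ : Fin n → W n → LF F n → Carrier
  Φ {n} i w L = ∑[ j < n ] (coord w L j * δ (toℕ j ℕ.≤? toℕ i))

  module _ (i : Fin n) (w : W n) where

    Φ-cong : {L L′ : LF F n} → (∀ m → L m ≈ L′ m) → Φ i w L ≈ Φ i w L′
    Φ-cong L≈L′ = sum-cong-≋ λ j → *-congʳ (coord-cong w L≈L′ j)

    Φ-sub : (L L′ : LF F n) → Φ i w (_-L_ F L L′) ≈ Φ i w L - Φ i w L′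
    Φ-sub L L′ = trans (sum-cong-≋ λ j → trans (*-congʳ (coord-sub w L L′ j)) ([y-z]x≈yx-zx _ _ _))
                       (∑-distrib-‿- (λ j → coord w L j * δ (toℕ j ℕ.≤? toℕ i))
                                     (λ j → coord w L′ j * δ (toℕ j ℕ.≤? toℕ i)))

    Φ-scale : (a : Carrier) (L : LF F n) → Φ i w (λ m → a * L m) ≈ a * Φ i w L
    Φ-scale a L = trans (sum-cong-≋ λ j → trans (*-congʳ (x∙yz≈y∙xz (s j) a (L (m j)))) (*-assoc a _ _))
                        (sym (*-distribˡ-sum a (λ j → coord w L j * δ (toℕ j ℕ.≤? toℕ i))))
      where
      s = sgn ∘ pos w
      m = absSI ∘ pos w

    Φ-var : (p : Fin n) → Φ i w (var F (pos w p)) ≈ δ (toℕ p ℕ.≤? toℕ i)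
    Φ-var p = begin
      Φ i w (var F (pos w p))                             ≈⟨ ∑-single _ p others ⟩
      coord w (var F (pos w p)) p * δ (toℕ p ℕ.≤? toℕ i)  ≈⟨ *-congʳ (coord-var w p p) ⟩
      δ (p Fin.≟ p) * δ (toℕ p ℕ.≤? toℕ i)                ≈⟨ *-comm _ _ ⟩
      δ (toℕ p ℕ.≤? toℕ i) * δ (p Fin.≟ p)                ≈⟨ *-δ-yes (p Fin.≟ p) ≡.refl _ ⟩
      δ (toℕ p ℕ.≤? toℕ i)                                ∎
      where
      others : ∀ j → j ≢ p → coord w (var F (pos w p)) j * δ (toℕ j ℕ.≤? toℕ i) ≈ 0#
      others j j≢p = trans (*-congʳ (trans (coord-var w p j) (reflexive (δ-no (p Fin.≟ j) (j≢p ∘ ≡.sym)))))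
                           (zeroˡ _)

    Φ-var-bar : (p : Fin n) → Φ i w (var F (bar (pos w p))) ≈ - δ (toℕ p ℕ.≤? toℕ i)
    Φ-var-bar p = begin
      Φ i w (var F (bar (pos w p)))          ≈⟨ Φ-cong (λ m → trans (var-bar (pos w p) m) (sym (-1*x≈-x _))) ⟩
      Φ i w (λ m → - 1# * var F (pos w p) m) ≈⟨ Φ-scale (- 1#) (var F (pos w p)) ⟩
      - 1# * Φ i w (var F (pos w p))         ≈⟨ -1*x≈-x _ ⟩
      - Φ i w (var F (pos w p))              ≈⟨ -‿cong (Φ-var p) ⟩
      - δ (toℕ p ℕ.≤? toℕ i)                 ∎

  adjacent-≤-iff : {k i : Fin n} (k<n : suc (toℕ k) ℕ.< n) → k ≢ i → ∀ j →
                   δ (toℕ (transpose k (k<n ⁺) j) ℕ.≤? toℕ i) ≡ δ (toℕ j ℕ.≤? toℕ i)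
  adjacent-≤-iff {k = k} {i} k<n k≢i j = δ-≡ (_ ℕ.≤? _) (_ ℕ.≤? _)
    (λ τj≤i → ≡.subst (λ x → toℕ x ℕ.≤ toℕ i) (transpose-involutive k (k<n ⁺) j)
                      (transpose-adjacent-≤ k<n k≢i τj≤i))
    (transpose-adjacent-≤ k<n k≢i)

  Φ-root : {k i : Fin n} {w w′ : W n} → Step k w w′ → k ≢ i →
           Φ i w (rootForm w w′ k) ≈ 0#
  Φ-root {n} {k} {i} {w} {w′} st k≢i =
    trans (Φ-sub i w (var F (pos w k)) (var F (pos w′ k))) (by-kind (suc (toℕ k) ℕ.<? n))
    where
    by-kind : Dec (suc (toℕ k) ℕ.< n) → Φ i w (var F (pos w k)) - Φ i w (var F (pos w′ k)) ≈ 0#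
    by-kind (yes k<n) = begin
      Φ i w (var F (pos w k)) - Φ i w (var F (pos w′ k))
        ≡⟨ ≡.cong (λ b → Φ i w (var F (pos w k)) - Φ i w (var F b)) (step-adjacent-here st k<n) ⟩
      Φ i w (var F (pos w k)) - Φ i w (var F (pos w (k<n ⁺)))
        ≈⟨ +-cong (Φ-var i w k) (-‿cong (Φ-var i w (k<n ⁺))) ⟩
      δ (toℕ k ℕ.≤? toℕ i) - δ (toℕ (k<n ⁺) ℕ.≤? toℕ i)
        ≡⟨ ≡.cong (λ d → δ (toℕ k ℕ.≤? toℕ i) - d)
                  (≡.trans (≡.cong (λ x → δ (toℕ x ℕ.≤? toℕ i)) (≡.sym (transpose-matchˡ k (k<n ⁺))))
                           (adjacent-≤-iff k<n k≢i k)) ⟩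
      δ (toℕ k ℕ.≤? toℕ i) - δ (toℕ k ℕ.≤? toℕ i)
        ≈⟨ -‿inverseʳ _ ⟩
      0# ∎
    by-kind (no k≮n) = begin
      Φ i w (var F (pos w k)) - Φ i w (var F (pos w′ k))
        ≡⟨ ≡.cong (λ b → Φ i w (var F (pos w k)) - Φ i w (var F b)) (step-last-here st k≮n) ⟩
      Φ i w (var F (pos w k)) - Φ i w (var F (bar (pos w k)))
        ≈⟨ +-cong (Φ-var i w k) (-‿cong (Φ-var-bar i w k)) ⟩
      δ (toℕ k ℕ.≤? toℕ i) - - δ (toℕ k ℕ.≤? toℕ i)
        ≡⟨ ≡.cong (λ d → d - - d) (δ-no (toℕ k ℕ.≤? toℕ i) k≰i) ⟩
      0# - - 0#
        ≈⟨ trans (+-congˡ (-‿cong -0#≈0#)) (x-0≈x 0#) ⟩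
      0# ∎
      where
      k≰i : ¬ toℕ k ℕ.≤ toℕ i
      k≰i k≤i = k≢i (Fin.toℕ-injective (ℕ.≤-antisym k≤i (last-max k≮n i)))

  Φ-step : {k i : Fin n} {w w′ : W n} → Step k w w′ → k ≢ i → ∀ L → Φ i w L ≈ Φ i w′ L
  Φ-step {n} {k} {i} {w} {w′} st k≢i L with suc (toℕ k) ℕ.<? n
  ... | yes k<n = trans (∑-permute summand (Perm.transpose k (k<n ⁺))) (sum-cong-≋ λ j → reflexive (
        ≡.cong₂ _*_ (≡.cong (λ b → sgn b * L (absSI b)) (≡.sym (step-adjacent st k<n j)))
                    (adjacent-≤-iff k<n k≢i j)))
    where
    summand : Fin n → Carrier
    summand j = coord w L j * δ (toℕ j ℕ.≤? toℕ i)
  ... | no k≮n = sum-cong-≋ same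
    where
    same : ∀ j → coord w L j * δ (toℕ j ℕ.≤? toℕ i) ≈ coord w′ L j * δ (toℕ j ℕ.≤? toℕ i)
    same j with toℕ j ℕ.≤? toℕ i
    ... | no j≰i  = trans (*-δ-no (toℕ j ℕ.≤? toℕ i) j≰i _) (sym (*-δ-no (toℕ j ℕ.≤? toℕ i) j≰i _))
    ... | yes j≤i =
      *-congʳ (reflexive (≡.cong (λ b → sgn b * L (absSI b)) (≡.sym (step-last-other st k≮n j≢k))))
      where
      j≢k : j ≢ k
      j≢k ≡.refl = k≢i (Fin.toℕ-injective (ℕ.≤-antisym j≤i (last-max k≮n i)))

  Φ-Δ : (w : W n) (L : LF F n) (j : Fin n) → Φ j w L - prev (λ i → Φ i w L) j ≈ coord w L j
  Φ-Δ w L Fin.zero = begin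
    Φ Fin.zero w L - 0#                          ≈⟨ x-0≈x _ ⟩
    Φ Fin.zero w L                               ≈⟨ ∑-single _ Fin.zero others ⟩
    coord w L Fin.zero * δ (0 ℕ.≤? 0)            ≈⟨ *-δ-yes (0 ℕ.≤? 0) ℕ.z≤n _ ⟩
    coord w L Fin.zero                           ∎
    where
    others : ∀ l → l ≢ Fin.zero → coord w L l * δ (toℕ l ℕ.≤? 0) ≈ 0#
    others l l≢0 = *-δ-no (toℕ l ℕ.≤? 0) (λ l≤0 → l≢0 (Fin.toℕ-injective (ℕ.n≤0⇒n≡0 l≤0))) _
  Φ-Δ {n} w L (Fin.suc j) = begin
    Φ (Fin.suc j) w L - Φ (inject₁ j) w L
      ≈⟨ ∑-distrib-‿- (summand (Fin.suc j)) (summand (inject₁ j)) ⟨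
    ∑[ l < n ] (summand (Fin.suc j) l - summand (inject₁ j) l)
      ≈⟨ ∑-single _ (Fin.suc j) others ⟩
    summand (Fin.suc j) (Fin.suc j) - summand (inject₁ j) (Fin.suc j)
      ≈⟨ +-cong (*-δ-yes (suc (toℕ j) ℕ.≤? suc (toℕ j)) ℕ.≤-refl _)
                (-‿cong (*-δ-no (suc (toℕ j) ℕ.≤? toℕ (inject₁ j)) 1+j≰j _)) ⟩
    coord w L (Fin.suc j) - 0#                   ≈⟨ x-0≈x _ ⟩
    coord w L (Fin.suc j)                        ∎
    where
    summand : Fin n → Fin n → Carrier
    summand i l = coord w L l * δ (toℕ l ℕ.≤? toℕ i)
    1+j≰j : ¬ suc (toℕ j) ℕ.≤ toℕ (inject₁ j)
    1+j≰j 1+j≤j = ℕ.<-irrefl ≡.refl (≡.subst (suc (toℕ j) ℕ.≤_) (Fin.toℕ-inject₁ j) 1+j≤j)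
    others : ∀ l → l ≢ Fin.suc j → summand (Fin.suc j) l - summand (inject₁ j) l ≈ 0#
    others l l≢1+j = trans (+-congˡ (-‿cong (reflexive (≡.cong (coord w L l *_) same-δ)))) (-‿inverseʳ _)
      where
      same-δ : δ (toℕ l ℕ.≤? toℕ (inject₁ j)) ≡ δ (toℕ l ℕ.≤? suc (toℕ j))
      same-δ = δ-≡ (_ ℕ.≤? _) (_ ℕ.≤? _)
        (λ l≤j → ℕ.m≤n⇒m≤1+n (≡.subst (toℕ l ℕ.≤_) (Fin.toℕ-inject₁ j) l≤j))
        (λ l≤1+j → ≡.subst (toℕ l ℕ.≤_) (≡.sym (Fin.toℕ-inject₁ j))
                     (ℕ.s≤s⁻¹ (ℕ.≤∧≢⇒< l≤1+j (l≢1+j ∘ Fin.toℕ-injective))))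

  reconstruction : (w : W n) (L : LF F n) → ∀ m → ∑[ i < n ] (Φ i w L * fForm F w i m) ≈ L m
  reconstruction w L =
    coord-injective w λ j → trans (coord-combination w (λ i → Φ i w L) j) (Φ-Δ w L j)

  InIdeal-zero : {L g : LF F n} → (∀ m → L m ≈ 0#) → InIdeal F L g
  InIdeal-zero L≈0 = 0# , λ m → trans (L≈0 m) (sym (zeroˡ _))

  InIdeal-neg : {L g L′ g′ : LF F n} → InIdeal F L g →
                (∀ m → L′ m ≈ - L m) → (∀ m → g′ m ≈ - g m) → InIdeal F L′ g′
  InIdeal-neg (a , L≈ag) L′≈-L g′≈-g = a , λ m →
    trans (L′≈-L m) (trans (-‿cong (L≈ag m)) (trans (-‿distribʳ-* a _) (*-congˡ (sym (g′≈-g m)))))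

  InM1-intro : {ρ : W n → LF F n} →
               (∀ {k w w′} → Step k w w′ → InIdeal F (_-L_ F (ρ w) (ρ w′)) (rootForm w w′ k)) →
               InM1 F n ρ
  InM1-intro {ρ = ρ} h w w′ k acts′ with e , e′ ← step-sPair (mkStep acts′) =
    ≡.subst₂ (λ a b → InIdeal F (_-L_ F (ρ w) (ρ w′)) (_-L_ F (var F a) (var F b)))
             (≡.sym e) (≡.sym e′) (h (mkStep acts′))

  InM1-elim : {ρ : W n → LF F n} → InM1 F n ρ → ∀ {k w w′} → Step k w w′ →
              InIdeal F (_-L_ F (ρ w) (ρ w′)) (rootForm w w′ k)
  InM1-elim {ρ = ρ} ρ∈M1 {k} {w} {w′} st with e , e′ ← step-sPair st =
    ≡.subst₂ (λ a b → InIdeal F (_-L_ F (ρ w) (ρ w′)) (_-L_ F (var F a) (var F b)))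
             e e′ (ρ∈M1 w w′ k (acts st))

  Φ-ρ-step : {ρ : W n → LF F n} → InM1 F n ρ → ∀ {k i w w′} → Step k w w′ → k ≢ i →
                Φ i w (ρ w) ≈ Φ i w′ (ρ w′)
  Φ-ρ-step {ρ = ρ} ρ∈M1 {k} {i} {w} {w′} st k≢i with a , ρw-ρw′≈a·g ← InM1-elim ρ∈M1 st =
    trans (x-y≈0⇒x≈y (begin
      Φ i w (ρ w) - Φ i w (ρ w′)          ≈⟨ Φ-sub i w (ρ w) (ρ w′) ⟨
      Φ i w (_-L_ F (ρ w) (ρ w′))         ≈⟨ Φ-cong i w ρw-ρw′≈a·g ⟩
      Φ i w (λ m → a * rootForm w w′ k m) ≈⟨ Φ-scale i w a (rootForm w w′ k) ⟩
      a * Φ i w (rootForm w w′ k)         ≈⟨ *-congˡ (Φ-root st k≢i) ⟩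
      a * 0#                              ≈⟨ zeroʳ a ⟩
      0#                                  ∎))
      (Φ-step st k≢i (ρ w′))
    where

  fForm-step : {k i : Fin n} {w w′ : W n} → Step k w w′ → k ≢ i →
               InIdeal F (_-L_ F (fForm F w i) (fForm F w′ i)) (rootForm w w′ k)
  fForm-step {n} {k} {i} {w} {w′} st k≢i with toℕ k ℕ.≟ suc (toℕ i) | suc (toℕ k) ℕ.≟ toℕ i
  ... | yes k≡1+i | _ = - 1# , λ m → begin
    fForm F w i m - fForm F w′ i m
      ≈⟨ +-cong (fForm≈var-next w i m) (-‿cong (fForm≈var-next w′ i m)) ⟩
    (var F (pos w i) m - next w i m) - (var F (pos w′ i) m - next w′ i m)
      ≡⟨ ≡.cong₂ (λ a b → (var F (pos w i) m - a m) - (var F (pos w′ i) m - b m)) next-w next-w′ ⟩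
    (var F (pos w i) m - var F (pos w k) m) - (var F (pos w′ i) m - var F (pos w′ k) m)
      ≡⟨ ≡.cong (λ b → (var F (pos w i) m - var F (pos w k) m) - (var F b m - var F (pos w′ k) m)) w′i≡wi ⟩
    (var F (pos w i) m - var F (pos w k) m) - (var F (pos w i) m - var F (pos w′ k) m)
      ≈⟨ [x-y]-[x-z]≈z-y _ _ _ ⟩
    var F (pos w′ k) m - var F (pos w k) m
      ≈⟨ ⁻¹-anti-homo‿- _ _ ⟨
    - (var F (pos w k) m - var F (pos w′ k) m)
      ≈⟨ -1*x≈-x _ ⟨
    - 1# * (var F (pos w k) m - var F (pos w′ k) m) ∎
    where
    i<n : suc (toℕ i) ℕ.< n
    i<n = ≡.subst (ℕ._< n) k≡1+i (Fin.toℕ<n k)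
    i⁺≡k : i<n ⁺ ≡ k
    i⁺≡k = Fin.toℕ-injective (≡.trans (toℕ-⁺ i<n) (≡.sym k≡1+i))
    next-w : next w i ≡ var F (pos w k)
    next-w = ≡.trans (next-adjacent w i<n) (≡.cong (var F ∘ pos w) i⁺≡k)
    next-w′ : next w′ i ≡ var F (pos w′ k)
    next-w′ = ≡.trans (next-adjacent w′ i<n) (≡.cong (var F ∘ pos w′) i⁺≡k)
    w′i≡wi : pos w′ i ≡ pos w i
    w′i≡wi = step-fixes st (λ e → ℕ.<-irrefl (≡.trans e k≡1+i) (ℕ.n<1+n _))
                           (λ e → ℕ.<-irrefl (≡.trans e (≡.cong suc k≡1+i)) (ℕ.m<n⇒m<1+n (ℕ.n<1+n _)))
  ... | no _ | yes 1+k≡i = - 1# , λ m → begin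
    fForm F w i m - fForm F w′ i m
      ≈⟨ +-cong (fForm≈var-next w i m) (-‿cong (fForm≈var-next w′ i m)) ⟩
    (var F (pos w i) m - next w i m) - (var F (pos w′ i) m - next w′ i m)
      ≡⟨ ≡.cong₂ (λ a b → (var F (pos w i) m - next w i m) - (var F a m - b m)) w′i≡wk next-w′≡next-w ⟩
    (var F (pos w i) m - next w i m) - (var F (pos w k) m - next w i m)
      ≈⟨ [x-z]-[y-z]≈x-y _ _ _ ⟩
    var F (pos w i) m - var F (pos w k) m
      ≡⟨ ≡.cong (λ b → var F b m - var F (pos w k) m) (≡.sym w′k≡wi) ⟩
    var F (pos w′ k) m - var F (pos w k) m
      ≈⟨ ⁻¹-anti-homo‿- _ _ ⟨
    - (var F (pos w k) m - var F (pos w′ k) m)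
      ≈⟨ -1*x≈-x _ ⟨
    - 1# * (var F (pos w k) m - var F (pos w′ k) m) ∎
    where
    k<n : suc (toℕ k) ℕ.< n
    k<n = ≡.subst (ℕ._< n) (≡.sym 1+k≡i) (Fin.toℕ<n i)
    k⁺≡i : k<n ⁺ ≡ i
    k⁺≡i = Fin.toℕ-injective (≡.trans (toℕ-⁺ k<n) 1+k≡i)
    w′i≡wk : pos w′ i ≡ pos w k
    w′i≡wk = ≡.trans (≡.cong (pos w′) (≡.sym k⁺≡i)) (step-adjacent-next st k<n)
    w′k≡wi : pos w′ k ≡ pos w i
    w′k≡wi = ≡.trans (step-adjacent-here st k<n) (≡.cong (pos w) k⁺≡i)
    next-w′≡next-w : next w′ i ≡ next w i
    next-w′≡next-w = next-cong λ i<n →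
      step-fixes st (λ e → ℕ.<-irrefl (≡.sym e) (ℕ.<-trans (ℕ.n<1+n _) (above i<n)))
                    (λ e → ℕ.<-irrefl (≡.sym e) (above i<n))
      where
      above : ∀ i<n → suc (toℕ k) ℕ.< toℕ (i<n ⁺)
      above i<n = ≡.subst (ℕ._< toℕ (i<n ⁺)) (≡.sym 1+k≡i) (ℕ.≤-reflexive (≡.sym (toℕ-⁺ i<n)))
  ... | no k≢1+i | no 1+k≢i = 0# , λ m → begin
    fForm F w i m - fForm F w′ i m
      ≈⟨ +-cong (fForm≈var-next w i m) (-‿cong (fForm≈var-next w′ i m)) ⟩
    (var F (pos w i) m - next w i m) - (var F (pos w′ i) m - next w′ i m)
      ≡⟨ ≡.cong₂ (λ a b → (var F (pos w i) m - next w i m) - (var F a m - b m)) w′i≡wi next-w′≡next-w ⟩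
    (var F (pos w i) m - next w i m) - (var F (pos w i) m - next w i m)
      ≈⟨ -‿inverseʳ _ ⟩
    0#
      ≈⟨ zeroˡ _ ⟨
    0# * (var F (pos w k) m - var F (pos w′ k) m) ∎
    where
    w′i≡wi : pos w′ i ≡ pos w i
    w′i≡wi = step-fixes st (k≢i ∘ Fin.toℕ-injective ∘ ≡.sym) (1+k≢i ∘ ≡.sym)
    next-w′≡next-w : next w′ i ≡ next w i
    next-w′≡next-w = next-cong λ i<n →
      step-fixes st (λ e → k≢1+i (≡.trans (≡.sym e) (toℕ-⁺ i<n)))
                    (λ e → k≢i (Fin.toℕ-injective (ℕ.suc-injective (≡.trans (≡.sym e) (toℕ-⁺ i<n)))))

  halving : ¬ (1# + 1# ≈ 0#) → ∃[ h ] (∀ x → x ≈ h * (x - - x))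
  halving 2≉0 with h , 2h≈1 ← inverse (1# + 1#) 2≉0 = h , λ x → begin
    x                     ≈⟨ *-identityˡ x ⟨
    1# * x                ≈⟨ *-congʳ (trans (*-comm h _) 2h≈1) ⟨
    (h * (1# + 1#)) * x   ≈⟨ *-assoc h _ x ⟩
    h * ((1# + 1#) * x)   ≈⟨ *-congˡ (trans (distribʳ x 1# 1#) (+-cong (*-identityˡ x) (*-identityˡ x))) ⟩
    h * (x + x)           ≈⟨ *-congˡ (+-congˡ (-‿involutive x)) ⟨
    h * (x - - x)         ∎

  fForm-step-self : ¬ (1# + 1# ≈ 0#) → {i : Fin n} {w w′ : W n} → Step i w w′ →
                    InIdeal F (_-L_ F (fForm F w i) (zeroLF F)) (rootForm w w′ i)
  fForm-step-self {n} 2≉0 {i} {w} {w′} st = by-kind (suc (toℕ i) ℕ.<? n)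
    where
    fForm≈ : ∀ m → fForm F w i m - 0# ≈ var F (pos w i) m - next w i m
    fForm≈ m = trans (x-0≈x _) (fForm≈var-next w i m)
    by-kind : Dec (suc (toℕ i) ℕ.< n) →
              InIdeal F (_-L_ F (fForm F w i) (zeroLF F)) (rootForm w w′ i)
    by-kind (yes i<n) = 1# , λ m → begin
      fForm F w i m - 0#                          ≈⟨ fForm≈ m ⟩
      var F (pos w i) m - next w i m              ≡⟨ ≡.cong (λ L → var F (pos w i) m - L m) next≡ ⟩
      var F (pos w i) m - var F (pos w′ i) m      ≈⟨ *-identityˡ _ ⟨
      1# * (var F (pos w i) m - var F (pos w′ i) m) ∎
      where
      next≡ : next w i ≡ var F (pos w′ i)
      next≡ = ≡.trans (next-adjacent w i<n) (≡.cong (var F) (≡.sym (step-adjacent-here st i<n)))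
    by-kind (no i≮n) = proj₁ (halving 2≉0) , λ m → begin
      fForm F w i m - 0#                          ≈⟨ fForm≈ m ⟩
      var F (pos w i) m - next w i m              ≡⟨ ≡.cong (λ L → var F (pos w i) m - L m) (next-last w i≮n) ⟩
      var F (pos w i) m - 0#                      ≈⟨ x-0≈x _ ⟩
      var F (pos w i) m                           ≈⟨ proj₂ (halving 2≉0) _ ⟩
      h * (var F (pos w i) m - - var F (pos w i) m)
        ≈⟨ *-congˡ (+-congˡ (-‿cong (w′i≈-wi m))) ⟨
      h * (var F (pos w i) m - var F (pos w′ i) m) ∎
      where
      h = proj₁ (halving 2≉0)
      w′i≈-wi : ∀ m → var F (pos w′ i) m ≈ - var F (pos w i) m
      w′i≈-wi m = trans (reflexive (≡.cong (λ b → var F b m) (step-last-here st i≮n))) (var-bar (pos w i) m)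

  𝐟-step : ¬ (1# + 1# ≈ 0#) → (i : Fin n) (A : Subset (n ℕ.+ n)) → ∀ {k w w′} → Step k w w′ →
           InIdeal F (_-L_ F (𝐟 F i A w) (𝐟 F i A w′)) (rootForm w w′ k)
  𝐟-step 2≉0 i A {k} {w} {w′} st with k Fin.≟ i
  ... | no k≢i with Vec.≡-dec Bool._≟_ (image w i) A | Vec.≡-dec Bool._≟_ (image w′ i) A
  ...   | yes _    | yes _   = fForm-step st k≢i
  ...   | no _     | no _    = InIdeal-zero λ _ → -‿inverseʳ 0#
  ...   | yes w↦A  | no w′↛A = ⊥-elim (w′↛A (≡.trans (≡.sym (image-step st k≢i)) w↦A))
  ...   | no w↛A   | yes w′↦A = ⊥-elim (w↛A (≡.trans (image-step st k≢i) w′↦A))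
  𝐟-step 2≉0 i A {k} {w} {w′} st | yes ≡.refl
    with Vec.≡-dec Bool._≟_ (image w i) A | Vec.≡-dec Bool._≟_ (image w′ i) A
  ... | yes w↦A | yes w′↦A = ⊥-elim (image-step-self st (≡.trans w↦A (≡.sym w′↦A)))
  ... | yes _   | no _     = fForm-step-self 2≉0 st
  ... | no _    | yes _    = InIdeal-neg (fForm-step-self 2≉0 (Step-sym st))
                               (λ m → trans (+-identityˡ _) (-‿cong (sym (x-0≈x _))))
                               (λ m → sym (⁻¹-anti-homo‿- _ _))
  ... | no _    | no _     = InIdeal-zero λ _ → -‿inverseʳ 0#

  𝐟-InM1 : ¬ (1# + 1# ≈ 0#) → (i : Fin n) (A : Subset (n ℕ.+ n)) → InM1 F n (𝐟 F i A)
  𝐟-InM1 2≉0 i A = InM1-intro (𝐟-step 2≉0 i A)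

  𝐟-image : (i : Fin n) (w : W n) → 𝐟 F i (image w i) w ≡ fForm F w i
  𝐟-image i w with Vec.≡-dec Bool._≟_ (image w i) (image w i)
  ... | yes _ = ≡.refl
  ... | no ≢  = ⊥-elim (≢ ≡.refl)

  𝐟-not-image : (i : Fin n) {A : Subset (n ℕ.+ n)} (w : W n) → A ≢ image w i → 𝐟 F i A w ≡ zeroLF F
  𝐟-not-image i {A} w A≢ with Vec.≡-dec Bool._≟_ (image w i) A
  ... | yes e = ⊥-elim (A≢ (≡.sym e))
  ... | no _  = ≡.refl

  combo-at-images : (coef : Fin n → Subset (n ℕ.+ n) → Carrier) (w : W n) (m : Fin n) →
                combo F coef w m ≈ ∑[ i < n ] (coef i (image w i) * fForm F w i m)
  combo-at-images {n} coef w m = begin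
    combo F coef w m
      ≈⟨ sumL-filter valid? term (cartesianProduct (List.allFin n) subsets) ⟩
    sumL (λ iA → if does (valid? iA) then term iA else 0#) (cartesianProduct (List.allFin n) subsets)
      ≈⟨ sumL-cartesianProduct (λ i → i) subsets (λ iA → if does (valid? iA) then term iA else 0#) ⟩
    ∑[ i < n ] sumL (λ A → if does (valid? (i , A)) then term (i , A) else 0#) subsets
      ≈⟨ sum-cong-≋ (λ i → sumL-allSubsets _ (image w i) (off-image i)) ⟩
    ∑[ i < n ] (if does (valid? (i , image w i)) then term (i , image w i) else 0#)
      ≈⟨ sum-cong-≋ at-image ⟩
    ∑[ i < n ] (coef i (image w i) * fForm F w i m) ∎
    where
    subsets = allSubsets (n ℕ.+ n)
    term : Fin n × Subset (n ℕ.+ n) → Carrier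
    term (i , A) = coef i A * 𝐟 F i A w m
    off-image : ∀ i A → A ≢ image w i → (if does (valid? (i , A)) then term (i , A) else 0#) ≈ 0#
    off-image i A A≢ with does (valid? (i , A))
    ... | false = refl
    ... | true  = trans (*-congˡ (reflexive (≡.cong (λ L → L m) (𝐟-not-image i w A≢)))) (zeroʳ _)
    at-image : ∀ i → (if does (valid? (i , image w i)) then term (i , image w i) else 0#) ≈
                     coef i (image w i) * fForm F w i m
    at-image i rewrite dec-true (valid? (i , image w i)) (image-valid w i) =
      *-congˡ (reflexive (≡.cong (λ L → L m) (𝐟-image i w)))

  combo≈0⇒coef≈0 : (coef : Fin n → Subset (n ℕ.+ n) → Carrier) → (∀ w m → combo F coef w m ≈ 0#) →
                   (w : W n) (i : Fin n) → coef i (image w i) ≈ 0#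
  combo≈0⇒coef≈0 {n} coef combo≈0 w = Δ-zero c Δc≈0
    where
    c : Fin n → Carrier
    c j = coef j (image w j)
    Δc≈0 : ∀ j → c j - prev c j ≈ 0#
    Δc≈0 j = begin
      c j - prev c j                                      ≈⟨ coord-combination w c j ⟨
      coord w (λ m → ∑[ i < n ] (c i * fForm F w i m)) j
        ≈⟨ coord-cong w (λ m → trans (sym (combo-at-images coef w m)) (combo≈0 w m)) j ⟩
      sgn (pos w j) * 0#                                  ≈⟨ zeroʳ _ ⟩
      0#                                                  ∎

  𝐟-independent : (coef : Fin n → Subset (n ℕ.+ n) → Carrier) → (∀ w m → combo F coef w m ≈ 0#) →
                  ∀ i A → Valid {n} i A → coef i A ≈ 0#
  𝐟-independent coef combo≈0 i A valid with w , ≡.refl ← image-surjective valid =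
    combo≈0⇒coef≈0 coef combo≈0 w i

  Φ-ρ-∼ : {ρ : W n → LF F n} → InM1 F n ρ → ∀ {i w w′} → w ∼[ i ] w′ → Φ i w (ρ w) ≈ Φ i w′ (ρ w′)
  Φ-ρ-∼ ρ∈M1 ε                          = refl
  Φ-ρ-∼ ρ∈M1 ((k , k≢i , st) ◅ w₁∼w′) = trans (Φ-ρ-step ρ∈M1 st k≢i) (Φ-ρ-∼ ρ∈M1 w₁∼w′)

  coefficient : (ρ : W n → LF F n) → Fin n → Subset (n ℕ.+ n) → Carrier
  coefficient ρ i A with valid? (i , A)
  ... | yes valid = let w , _ = image-surjective valid in Φ i w (ρ w)
  ... | no _      = 0#

  coefficient-image : {ρ : W n → LF F n} → InM1 F n ρ →
                      ∀ i w → coefficient ρ i (image w i) ≈ Φ i w (ρ w)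
  coefficient-image ρ∈M1 i w with valid? (i , image w i)
  ... | yes valid = Φ-ρ-∼ ρ∈M1 (image-fibre-connected (proj₂ (image-surjective valid)))
  ... | no invalid = ⊥-elim (invalid (image-valid w i))

  combo-coefficient : {ρ : W n → LF F n} → InM1 F n ρ → ∀ w m → combo F (coefficient ρ) w m ≈ ρ w m
  combo-coefficient {n} {ρ} ρ∈M1 w m = begin
    combo F (coefficient ρ) w m                               ≈⟨ combo-at-images (coefficient ρ) w m ⟩
    ∑[ i < n ] (coefficient ρ i (image w i) * fForm F w i m)
      ≈⟨ sum-cong-≋ (λ i → *-congʳ (coefficient-image ρ∈M1 i w)) ⟩
    ∑[ i < n ] (Φ i w (ρ w) * fForm F w i m)                  ≈⟨ reconstruction w (ρ w) m ⟩
    ρ w m                                                     ∎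

lemma8p1 : ∀ {c ℓ} (F : Field c ℓ) → CharZero F →
    (n : ℕ) → 2 ≤ n → IsBasisOfM1 F n
lemma8p1 F char0 n _ =
  (λ i A _ → 𝐟-InM1 2≉0 i A) , 𝐟-independent , λ ρ ρ∈M1 → coefficient ρ , combo-coefficient ρ∈M1
  where
  open Field F
  open LinearForms F
  2≉0 : ¬ (1# + 1# ≈ 0#)
  2≉0 = char0 1 ∘ trans (+-congˡ (+-identityʳ 1#))
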